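{- Let $m,M$ be positive integers and $L,p$ numbers with $L\geq 2^{m+M}+m+M$ and $p\leq 2^{m-1}$. Let $T$ be a tournament on at least $25\cdot 2^{2m+2M}$ vertices and $Y\subseteq V(T)$ with $|Y|\leq |T|/25-2^{2m+2M}$. Then $T$ contains an $(m,M,p)$-outdominator $D^+=(B^1,B^2,B^3,B^4,E^+)$ with an exceptional set $X$ such that $Y\cap V(D^+)=\emptyset$, $Y\subseteq X$, $|X|\leq L+|Y|$, and all vertices of $B^1$ have large out-degree in $T$.
   Context: A tournament has exactly one directed edge between each pair of distinct vertices. A tournament is transitive iff its vertices can be ordered $v_1,\dots,v_k$ with edges exactly $v_iv_j$ ($i<j$); $v_1$ is its tail and $v_k$ its head. A set $S$ out-dominates a set $B$ if for every $b\in B\setminus S$ there is $s\in S$ with $sb$ an edge. A vertex $v$ has large out-degree in $T$ if fewer than $|T|/25$ vertices $u$ of $T$ satisfy $d^+(u)>d^+(v)$. An $(m,M,p)$-outdominator in a tournament $T$ is a 5-tuple $(B^1,B^2,B^3,B^4,E^+)$ of sets of vertices of $T$ such that: (D1) $B^1,\dots,B^4$ are pairwise disjoint; (D2) for $i=1,2,3$ the subtournament on $B^i\cup B^{i+1}$ is transitive with head in $B^i$ and tail in $B^{i+1}$; (D3) $|B^2|=|B^3|=m$; (D4) $|B^1|=|B^4|=M$; (D5) $B^2\cup B^3$ out-dominates $V(T)\setminus(B^1\cup B^2\cup B^3\cup B^4\cup E^+)$; (D6) $d^-(v)\geq p|E^+|$ for every $v\in E^+$ (in-degree in $T$). Its vertex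 set is $V(D^+)=B^1\cup B^2\cup B^3\cup B^4$. $D^+$ is an $(m,M,p)$-outdominator in $T$ with exceptional set $X\subseteq V(T)$ if it is an $(m,M,p)$-outdominator in the subtournament of $T$ induced on $(V(T)\setminus X)\cup V(D^+)$. -}

module Defs where

open import Data.Nat as ℕ using (ℕ; zero; suc; _+_; _*_; _^_; _∸_; _<ᵇ_)
open import Data.Integer using (+_)
open import Data.Rational as ℚ using (ℚ; _/_)
open import Data.Bool using (Bool; true; false; not)
open import Data.Fin using (Fin; fromℕ) renaming (zero to fzero; _<_ to _<ᶠ_)
open import Data.Fin.Subset using (Subset; _∈_; _∉_; _⊆_; _∩_; _∪_; ∁; ∣_∣; Empty)
open import Data.Vec using (tabulate)
open import Data.Product using (Σ; ∃; _×_; _,_)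
open import Function.Definitions using (Injective)
open import Relation.Binary.PropositionalEquality using (_≡_; _≢_)
open import Relation.Nullary using (¬_)

record Tournament (n : ℕ) : Set where
  field
    adj     : Fin n → Fin n → Bool
    irrefl  : ∀ v → adj v v ≡ false
    oneEdge : ∀ u v → u ≢ v → adj u v ≡ not (adj v u)
open Tournament public

⟦_⟧ : ℕ → ℚ
⟦ k ⟧ = + k / 1

module _ {n : ℕ} (T : Tournament n) where

  outNbhd : Fin n → Subset n
  outNbhd v = tabulate (λ u → adj T v u)

  inNbhd : Fin n → Subset n
  inNbhd v = tabulate (λ u → adj T u v)

  outdeg : Fin n → ℕ
  outdeg v = ∣ outNbhd v ∣

  indegIn : Subset n → Fin n → ℕ
  indegIn W v = ∣ W ∩ inNbhd v ∣

  LargeOutdeg : Fin n → Set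
  LargeOutdeg v =
    25 * ∣ tabulate (λ u → outdeg v <ᵇ outdeg u) ∣ ℕ.< n

  TransitiveHT : Subset n → Fin n → Fin n → Set
  TransitiveHT S h t =
    Σ ℕ λ k → Σ (Fin (suc k) → Fin n) λ ord →
      Injective _≡_ _≡_ ord
      × (∀ x → x ∈ S → ∃ λ a → ord a ≡ x)
      × (∀ a → ord a ∈ S)
      × (∀ a b → a <ᶠ b → adj T (ord a) (ord b) ≡ true)
      × ord fzero ≡ t
      × ord (fromℕ k) ≡ h

  TransitiveHeadTail : Subset n → Subset n → Set
  TransitiveHeadTail A B =
    ∃ λ h → ∃ λ t → h ∈ A × t ∈ B × TransitiveHT (A ∪ B) h t

  Disjoint : Subset n → Subset n → Set
  Disjoint A B = Empty (A ∩ B)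

  OutDominates : Subset n → Subset n → Set
  OutDominates S B = ∀ b → b ∈ B → b ∉ S → ∃ λ s → s ∈ S × adj T s b ≡ true

  record Outdom : Set where
    constructor mkOutdom
    field
      B1 B2 B3 B4 E⁺ : Subset n
  open Outdom public

  VD : Outdom → Subset n
  VD D = B1 D ∪ B2 D ∪ B3 D ∪ B4 D

  IsOutdominatorIn : ℕ → ℕ → ℚ → Subset n → Outdom → Set
  IsOutdominatorIn m M p W D =
      (B1 D ∪ B2 D ∪ B3 D ∪ B4 D ∪ E⁺ D) ⊆ W
    × Disjoint (B1 D) (B2 D) × Disjoint (B1 D) (B3 D) × Disjoint (B1 D) (B4 D)
    × Disjoint (B2 D) (B3 D) × Disjoint (B2 D) (B4 D) × Disjoint (B3 D) (B4 D)
    × TransitiveHeadTail (B1 D) (B2 D)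
    × TransitiveHeadTail (B2 D) (B3 D)
    × TransitiveHeadTail (B3 D) (B4 D)
    × ∣ B2 D ∣ ≡ m × ∣ B3 D ∣ ≡ m
    × ∣ B1 D ∣ ≡ M × ∣ B4 D ∣ ≡ M
    × OutDominates (B2 D ∪ B3 D) (W ∩ ∁ (VD D ∪ E⁺ D))
    × (∀ v → v ∈ E⁺ D → p ℚ.* ⟦ ∣ E⁺ D ∣ ⟧ ℚ.≤ ⟦ indegIn W v ⟧)

  IsOutdominatorExc : ℕ → ℕ → ℚ → Subset n → Outdom → Set
  IsOutdominatorExc m M p X D = IsOutdominatorIn m M p (∁ X ∪ VD D) D

-- Averaging over out-degree thresholds, at least |T|/25 vertices have large out-degree, so at
-- least 4^(M+m) of them avoid Y. Every set S contains a vertex with at least (|S| - 1)/2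
-- in-neighbours in S; moving repeatedly into such in-neighbourhoods gives a transitive chain
-- B¹B² of these vertices with a set Q of 2^(M+m) common in-neighbours outside Y, and B²
-- out-dominates everything outside Q. Inside Q, B³ is chosen greedily, with a threshold τ that
-- halves at each step: vertices of in-degree below τ are fewer than 2τ and become exceptional,
-- the remaining vertex w of least in-degree joins B³, and the search continues in its
-- in-neighbourhood, which has at most half of the remaining vertices. As soon as some vertex has
-- in-degree in [τ, 3τ], its in-neighbourhood is made exceptional and provides the rest of B³
-- and B⁴. The vertices left over form E⁺; each has in-degree at least that of the last w, which
-- is at least 2^(m-1)|E⁺|, and the exceptional set has at most 2^(m+M) vertices besides Y.

module Submission where

open import Defs
open import Data.Nat
  using (ℕ; zero; suc; _+_; _*_; _^_; _∸_; _⊓_; _≤_; _<_; _<ᵇ_; _≤ᵇ_; z≤n; s≤s; _≤?_)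
open import Data.Nat.Properties
open import Data.Nat.Coprimality using (Coprime; 1-coprimeTo)
import Data.Nat.Coprimality as Coprimality
open import Data.Bool using (Bool; true; false; not; _∧_; _∨_)
import Data.Bool as Bool
open import Data.Bool.Properties using (∧-identityʳ; ∧-zeroʳ; ∧-assoc; ∨-assoc; T-≡)
open import Data.Fin using (Fin; zero; suc; toℕ; fromℕ; opposite)
import Data.Fin as Fin
import Data.Fin.Properties as Fin
open import Data.Fin.Subset using (Subset; _∈_; _⊆_; _∪_; _∩_; ∁; ∣_∣; Empty)
import Data.Fin.Subset.Properties as Subset
open import Data.Vec using ([]; _∷_; tabulate)
import Data.Vec as Vec
import Data.Vec.Properties as Vec
open import Data.List using (List; []; _∷_; [_]; length; _++_; lookup; take; drop)
open import Data.List.Properties using (length-++; length-take; length-drop; take++drop≡id)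
import Data.Integer as ℤ
import Data.Integer.Properties as ℤ
open import Data.Rational as ℚ using (ℚ; mkℚ)
import Data.Rational.Properties as ℚ
open import Data.Product using (Σ; ∃; _×_; _,_; proj₁; proj₂)
open import Data.Sum using (_⊎_; inj₁; inj₂)
open import Data.Empty using (⊥; ⊥-elim)
open import Data.Unit using (⊤; tt)
open import Function.Bundles using (Equivalence)
open import Relation.Nullary using (¬_; does; yes; no; _×-dec_)
open import Relation.Unary using (Decidable)
open import Relation.Binary using (tri<; tri≈; tri>)
open import Relation.Binary.PropositionalEquality
  using (_≡_; _≢_; refl; sym; trans; cong; cong₂; subst; subst₂; module ≡-Reasoning)
open import Algebra.Properties.Semiring.Sum +-*-semiring
  using (sum; sum-cong-≗; ∑-distrib-+; ∑-comm; *-distribˡ-sum; sum-replicate-zero)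

∧-elim : ∀ {a b} → a ∧ b ≡ true → a ≡ true × b ≡ true
∧-elim {true} {true} _ = refl , refl

∧-intro : ∀ {a b} → a ≡ true → b ≡ true → a ∧ b ≡ true
∧-intro refl refl = refl

∨-elim : ∀ {a b} → a ∨ b ≡ true → a ≡ true ⊎ b ≡ true
∨-elim {true}         _ = inj₁ refl
∨-elim {false} {true} _ = inj₂ refl

∨-introˡ : ∀ {a} b → a ≡ true → a ∨ b ≡ true
∨-introˡ b refl = refl

∨-introʳ : ∀ a {b} → b ≡ true → a ∨ b ≡ true
∨-introʳ true  _ = refl
∨-introʳ false e = e

∨-falseˡ : ∀ a {b} → a ∨ b ≡ false → a ≡ false
∨-falseˡ false _ = refl

∨-falseʳ : ∀ a {b} → a ∨ b ≡ false → b ≡ false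
∨-falseʳ false e = e

∨-trueˡ : ∀ {a b} → a ∨ b ≡ true → b ≡ false → a ≡ true
∨-trueˡ {true}  _ _    = refl
∨-trueˡ {false} e refl = e

∧-falseʳ : ∀ {a b} → a ≡ true → a ∧ b ≡ false → b ≡ false
∧-falseʳ refl b≡false = b≡false

not-true : ∀ {a} → a ≡ false → not a ≡ true
not-true refl = refl

not-false : ∀ {a} → not a ≡ true → a ≡ false
not-false {false} _ = refl

true≢false : ∀ {a} → a ≡ true → a ≡ false → ⊥
true≢false refl ()

_==_ : ∀ {n} → Fin n → Fin n → Bool
i == j = does (i Fin.≟ j)

==⇒≡ : ∀ {n} {i j : Fin n} → i == j ≡ true → i ≡ j
==⇒≡ {i = i} {j} e with i Fin.≟ j
... | yes i≡j = i≡j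

==-refl : ∀ {n} (i : Fin n) → i == i ≡ true
==-refl i with i Fin.≟ i
... | yes _  = refl
... | no i≢i = ⊥-elim (i≢i refl)

<ᵇ≡true⇒< : ∀ m n → (m <ᵇ n) ≡ true → m < n
<ᵇ≡true⇒< m n m<ᵇn = <ᵇ⇒< m n (Equivalence.from T-≡ m<ᵇn)

<⇒<ᵇ≡true : ∀ {m n} → m < n → (m <ᵇ n) ≡ true
<⇒<ᵇ≡true m<n = Equivalence.to T-≡ (<⇒<ᵇ m<n)

<ᵇ≡false⇒≥ : ∀ {m n} → (m <ᵇ n) ≡ false → n ≤ m
<ᵇ≡false⇒≥ m≮ᵇn = ≮⇒≥ (λ m<n → true≢false (<⇒<ᵇ≡true m<n) m≮ᵇn)

≤ᵇ≡true⇒≤ : ∀ m n → (m ≤ᵇ n) ≡ true → m ≤ n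
≤ᵇ≡true⇒≤ m n m≤ᵇn = ≤ᵇ⇒≤ m n (Equivalence.from T-≡ m≤ᵇn)

≤⇒≤ᵇ≡true : ∀ {m n} → m ≤ n → (m ≤ᵇ n) ≡ true
≤⇒≤ᵇ≡true m≤n = Equivalence.to T-≡ (≤⇒≤ᵇ m≤n)

-- Vertex sets are Boolean predicates on Fin n; the subsets of the statement are their tabulations.
𝟙 : Bool → ℕ
𝟙 true  = 1
𝟙 false = 0

count : ∀ {n} → (Fin n → Bool) → ℕ
count S = sum (λ i → 𝟙 (S i))

sum-mono : ∀ {n} {f g : Fin n → ℕ} → (∀ i → f i ≤ g i) → sum f ≤ sum g
sum-mono {zero}  _ = z≤n
sum-mono {suc n} f≤g = +-mono-≤ (f≤g zero) (sum-mono (λ i → f≤g (suc i)))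

count-cong : ∀ {n} {S S′ : Fin n → Bool} → (∀ x → S x ≡ S′ x) → count S ≡ count S′
count-cong S≗S′ = sum-cong-≗ (λ i → cong 𝟙 (S≗S′ i))

count-mono : ∀ {n} {S S′ : Fin n → Bool} →
  (∀ x → S x ≡ true → S′ x ≡ true) → count S ≤ count S′
count-mono S⊆S′ = sum-mono (λ i → 𝟙-mono (S⊆S′ i))
  where
  𝟙-mono : ∀ {a b} → (a ≡ true → b ≡ true) → 𝟙 a ≤ 𝟙 b
  𝟙-mono {true}  a⇒b rewrite a⇒b refl = ≤-refl
  𝟙-mono {false} _ = z≤n

count-false : ∀ {n} → count {n} (λ _ → false) ≡ 0
count-false {n} = sum-replicate-zero n

count-true : ∀ {n} → count {n} (λ _ → true) ≡ n
count-true {zero}  = refl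
count-true {suc n} = cong suc count-true

count-split : ∀ {n} (S P : Fin n → Bool) →
  count S ≡ count (λ x → S x ∧ P x) + count (λ x → S x ∧ not (P x))
count-split S P = trans (sum-cong-≗ (λ i → 𝟙-split (S i) (P i)))
  (∑-distrib-+ (λ x → 𝟙 (S x ∧ P x)) (λ x → 𝟙 (S x ∧ not (P x))))
  where
  𝟙-split : ∀ a b → 𝟙 a ≡ 𝟙 (a ∧ b) + 𝟙 (a ∧ not b)
  𝟙-split true  true  = refl
  𝟙-split true  false = refl
  𝟙-split false _     = refl

count-∨ : ∀ {n} (S S′ : Fin n → Bool) → count (λ x → S x ∨ S′ x) ≤ count S + count S′
count-∨ S S′ = ≤-trans (sum-mono (λ i → 𝟙-∨ (S i) (S′ i)))
  (≤-reflexive (∑-distrib-+ (λ x → 𝟙 (S x)) (λ x → 𝟙 (S′ x))))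
  where
  𝟙-∨ : ∀ a b → 𝟙 (a ∨ b) ≤ 𝟙 a + 𝟙 b
  𝟙-∨ true  _ = s≤s z≤n
  𝟙-∨ false _ = ≤-refl

count-∨-disjoint : ∀ {n} (S S′ : Fin n → Bool) → (∀ x → S x ≡ true → S′ x ≡ false) →
  count (λ x → S x ∨ S′ x) ≡ count S + count S′
count-∨-disjoint S S′ disj = trans (sum-cong-≗ (λ i → 𝟙-∨ (S i) (S′ i) (disj i)))
  (∑-distrib-+ (λ x → 𝟙 (S x)) (λ x → 𝟙 (S′ x)))
  where
  𝟙-∨ : ∀ a b → (a ≡ true → b ≡ false) → 𝟙 (a ∨ b) ≡ 𝟙 a + 𝟙 b
  𝟙-∨ true  _ a⇒¬b rewrite a⇒¬b refl = refl
  𝟙-∨ false _ _ = refl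

count-nonempty : ∀ {n} (S : Fin n → Bool) → 1 ≤ count S → ∃ λ x → S x ≡ true
count-nonempty {suc n} S 1≤∣S∣ with S zero in S₀
... | true  = zero , S₀
... | false with count-nonempty (λ i → S (suc i)) 1≤∣S∣
...   | x , Sx = suc x , Sx

count-∧-== : ∀ {n} (S : Fin n → Bool) (v : Fin n) → count (λ u → S u ∧ (u == v)) ≡ 𝟙 (S v)
count-∧-== {suc n} S zero = trans
  (cong₂ _+_ (cong 𝟙 (∧-identityʳ (S zero)))
             (trans (count-cong (λ i → ∧-zeroʳ (S (suc i)))) (count-false {n})))
  (+-identityʳ _)
count-∧-== {suc n} S (suc v) = trans
  (cong (_+ count (λ u → S (suc u) ∧ (u == v))) (cong 𝟙 (∧-zeroʳ (S zero))))
  (count-∧-== (λ i → S (suc i)) v)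

count-== : ∀ {n} (v : Fin n) → count (_== v) ≡ 1
count-== v = count-∧-== (λ _ → true) v

sum-restrict-mono : ∀ {n} (S : Fin n → Bool) {g h : Fin n → ℕ} → (∀ i → S i ≡ true → g i ≤ h i) →
  sum (λ i → 𝟙 (S i) * g i) ≤ sum (λ i → 𝟙 (S i) * h i)
sum-restrict-mono S {g} {h} g≤h = sum-mono pointwise
  where
  pointwise : ∀ i → 𝟙 (S i) * g i ≤ 𝟙 (S i) * h i
  pointwise i with S i in Si
  ... | true  = +-mono-≤ (g≤h i Si) z≤n
  ... | false = z≤n

sum-restrict-const : ∀ {n} (S : Fin n → Bool) (c : ℕ) → sum (λ i → 𝟙 (S i) * c) ≡ count S * c
sum-restrict-const S c = begin
  sum (λ i → 𝟙 (S i) * c) ≡⟨ sum-cong-≗ (λ i → *-comm (𝟙 (S i)) c) ⟩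
  sum (λ i → c * 𝟙 (S i)) ≡⟨ *-distribˡ-sum c (λ i → 𝟙 (S i)) ⟨
  c * count S             ≡⟨ *-comm c (count S) ⟩
  count S * c             ∎
  where open ≡-Reasoning

2*m≤2*n+1⇒m≤n : ∀ m n → 2 * m ≤ 2 * n + 1 → m ≤ n
2*m≤2*n+1⇒m≤n m n 2m≤2n+1 = ≤-pred (*-cancelˡ-< 2 m (suc n) (≤-trans (s≤s 2m≤2n+1) 2n+2≤2[n+1]))
  where
  2n+2≤2[n+1] : suc (2 * n + 1) ≤ 2 * suc n
  2n+2≤2[n+1] = ≤-reflexive (trans (cong suc (+-comm (2 * n) 1)) (sym (*-suc 2 n)))

∃-minimiser : ∀ {n} (S : Fin n → Bool) (g : Fin n → ℕ) → (∃ λ v → S v ≡ true) →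
  ∃ λ w → S w ≡ true × (∀ u → S u ≡ true → g w ≤ g u)
∃-minimiser S g (v , Sv) = descend (g v) v Sv ≤-refl
  where
  descend : ∀ d v → S v ≡ true → g v ≤ d → ∃ λ w → S w ≡ true × (∀ u → S u ≡ true → g w ≤ g u)
  descend zero    v Sv gv≤0 = v , Sv , λ u _ → ≤-trans gv≤0 z≤n
  descend (suc d) v Sv gv≤d+1 with Fin.any? (λ u → (S u Bool.≟ true) ×-dec (g u ≤? d))
  ... | yes (u , Su , gu≤d) = descend d u Su gu≤d
  ... | no none = v , Sv , λ u Su → ≤-trans gv≤d+1 (≮⇒≥ (λ gu<d+1 → none (u , Su , ≤-pred gu<d+1)))

∃-crossing : ∀ {P : ℕ → Set} → Decidable P → P 0 → ∀ j → ¬ P j → ∃ λ d → P d × ¬ P (suc d)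
∃-crossing P? P0 zero    ¬P0 = ⊥-elim (¬P0 P0)
∃-crossing P? P0 (suc j) ¬Pj+1 with P? j
... | yes Pj = j , Pj , ¬Pj+1
... | no ¬Pj = ∃-crossing P? P0 j ¬Pj

∈-tabulate⁻ : ∀ {n} {f : Fin n → Bool} {x} → x ∈ tabulate f → f x ≡ true
∈-tabulate⁻ {f = f} {x} x∈ = trans (sym (Vec.lookup∘tabulate f x)) (Vec.[]=⇒lookup x∈)

∈-tabulate⁺ : ∀ {n} {f : Fin n → Bool} {x} → f x ≡ true → x ∈ tabulate f
∈-tabulate⁺ {f = f} {x} fx = Vec.lookup⇒[]= x (tabulate f) (trans (Vec.lookup∘tabulate f x) fx)

∣p∣≡count : ∀ {n} (p : Subset n) → ∣ p ∣ ≡ count (Vec.lookup p)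
∣p∣≡count []          = refl
∣p∣≡count (true ∷ p)  = cong suc (∣p∣≡count p)
∣p∣≡count (false ∷ p) = ∣p∣≡count p

∣tabulate∣≡count : ∀ {n} (f : Fin n → Bool) → ∣ tabulate f ∣ ≡ count f
∣tabulate∣≡count f = trans (∣p∣≡count (tabulate f)) (count-cong (Vec.lookup∘tabulate f))

tabulate-∪ : ∀ {n} (f g : Fin n → Bool) → tabulate f ∪ tabulate g ≡ tabulate (λ x → f x ∨ g x)
tabulate-∪ {zero}  f g = refl
tabulate-∪ {suc n} f g =
  cong ((f Fin.zero ∨ g Fin.zero) ∷_) (tabulate-∪ (λ i → f (Fin.suc i)) (λ i → g (Fin.suc i)))

tabulate-∩ : ∀ {n} (f g : Fin n → Bool) → tabulate f ∩ tabulate g ≡ tabulate (λ x → f x ∧ g x)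
tabulate-∩ {zero}  f g = refl
tabulate-∩ {suc n} f g =
  cong ((f Fin.zero ∧ g Fin.zero) ∷_) (tabulate-∩ (λ i → f (Fin.suc i)) (λ i → g (Fin.suc i)))

∁-tabulate : ∀ {n} (f : Fin n → Bool) → ∁ (tabulate f) ≡ tabulate (λ x → not (f x))
∁-tabulate f = sym (Vec.tabulate-∘ not f)

⊆-tabulate : ∀ {n} {f g : Fin n → Bool} → (∀ x → f x ≡ true → g x ≡ true) → tabulate f ⊆ tabulate g
⊆-tabulate f⇒g x∈ = ∈-tabulate⁺ (f⇒g _ (∈-tabulate⁻ x∈))

Disjoint-tabulate : ∀ {n} (T : Tournament n) {f g : Fin n → Bool} →
  (∀ x → f x ≡ true → g x ≡ true → ⊥) → Disjoint T (tabulate f) (tabulate g)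
Disjoint-tabulate T {f} {g} f∩g≡∅ (x , x∈) =
  let (x∈f , x∈g) = Subset.x∈p∩q⁻ (tabulate f) (tabulate g) x∈ in
  f∩g≡∅ x (∈-tabulate⁻ x∈f) (∈-tabulate⁻ x∈g)

-- In-degrees in subtournaments

module _ {n : ℕ} (T : Tournament n) where

  private
    A = adj T

  adj-flip : ∀ u v → u ≢ v → A u v ≡ false → A v u ≡ true
  adj-flip u v u≢v Auv = trans (oneEdge T v u (λ v≡u → u≢v (sym v≡u))) (cong not Auv)

  adj-asym : ∀ u v → A u v ≡ true → A v u ≡ true → ⊥
  adj-asym u v Auv Avu with u Fin.≟ v
  ... | yes refl = true≢false Auv (irrefl T u)
  ... | no u≢v  = true≢false Auv (trans (oneEdge T u v u≢v) (cong not Avu))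

  in-neighbours : (Fin n → Bool) → Fin n → Fin n → Bool
  in-neighbours S v u = S u ∧ A u v

  d⁻ d⁺ : (Fin n → Bool) → Fin n → ℕ
  d⁻ S v = count (in-neighbours S v)
  d⁺ S v = count (λ u → S u ∧ A v u)

  weighted : (Fin n → Bool) → (Fin n → ℕ) → ℕ
  weighted S f = sum (λ v → 𝟙 (S v) * f v)

  d⁻+d⁺ : ∀ S v → d⁻ S v + d⁺ S v + 𝟙 (S v) ≡ count S
  d⁻+d⁺ S v = begin
    d⁻ S v + d⁺ S v + 𝟙 (S v)
      ≡⟨ cong (d⁻ S v + d⁺ S v +_) (count-∧-== S v) ⟨
    d⁻ S v + d⁺ S v + count (λ u → S u ∧ (u == v))
      ≡⟨ cong (_+ count (λ u → S u ∧ (u == v))) (∑-distrib-+ (λ u → 𝟙 (S u ∧ A u v)) _) ⟨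
    sum (λ u → 𝟙 (S u ∧ A u v) + 𝟙 (S u ∧ A v u)) + count (λ u → S u ∧ (u == v))
      ≡⟨ ∑-distrib-+ (λ u → 𝟙 (S u ∧ A u v) + 𝟙 (S u ∧ A v u)) _ ⟨
    sum (λ u → 𝟙 (S u ∧ A u v) + 𝟙 (S u ∧ A v u) + 𝟙 (S u ∧ (u == v)))
      ≡⟨ sum-cong-≗ exactly-one ⟩
    count S ∎
    where
    open ≡-Reasoning
    exactly-one : ∀ u → 𝟙 (S u ∧ A u v) + 𝟙 (S u ∧ A v u) + 𝟙 (S u ∧ (u == v)) ≡ 𝟙 (S u)
    exactly-one u with u Fin.≟ v
    ... | yes refl rewrite irrefl T u with S u
    ...   | true  = refl
    ...   | false = refl
    exactly-one u | no u≢v rewrite oneEdge T u v u≢v with S u | A v u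
    ...   | true  | true  = refl
    ...   | true  | false = refl
    ...   | false | _     = refl

  weighted-d⁻≡weighted-d⁺ : ∀ S → weighted S (d⁻ S) ≡ weighted S (d⁺ S)
  weighted-d⁻≡weighted-d⁺ S = begin
    sum (λ v → 𝟙 (S v) * d⁻ S v)
      ≡⟨ sum-cong-≗ (λ v → *-distribˡ-sum (𝟙 (S v)) (λ u → 𝟙 (S u ∧ A u v))) ⟩
    sum (λ v → sum (λ u → 𝟙 (S v) * 𝟙 (S u ∧ A u v)))
      ≡⟨ ∑-comm (λ v u → 𝟙 (S v) * 𝟙 (S u ∧ A u v)) ⟩
    sum (λ u → sum (λ v → 𝟙 (S v) * 𝟙 (S u ∧ A u v)))
      ≡⟨ sum-cong-≗ (λ u → sum-cong-≗ (λ v → swap (S v) (S u) (A u v))) ⟩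
    sum (λ u → sum (λ v → 𝟙 (S u) * 𝟙 (S v ∧ A u v)))
      ≡⟨ sum-cong-≗ (λ u → *-distribˡ-sum (𝟙 (S u)) (λ v → 𝟙 (S v ∧ A u v))) ⟨
    sum (λ u → 𝟙 (S u) * d⁺ S u) ∎
    where
    open ≡-Reasoning
    swap : ∀ a b c → 𝟙 a * 𝟙 (b ∧ c) ≡ 𝟙 b * 𝟙 (a ∧ c)
    swap true  true  c = refl
    swap true  false c = refl
    swap false true  c = refl
    swap false false c = refl

  weighted-+ : ∀ S f g → weighted S (λ v → f v + g v) ≡ weighted S f + weighted S g
  weighted-+ S f g = trans (sum-cong-≗ (λ v → *-distribˡ-+ (𝟙 (S v)) (f v) (g v)))
    (∑-distrib-+ (λ v → 𝟙 (S v) * f v) (λ v → 𝟙 (S v) * g v))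

  handshake : ∀ S → 2 * weighted S (d⁻ S) + count S ≡ count S * count S
  handshake S = begin
    2 * D + count S
      ≡⟨ cong (λ x → D + x + count S) (trans (+-identityʳ D) (weighted-d⁻≡weighted-d⁺ S)) ⟩
    D + weighted S (d⁺ S) + count S
      ≡⟨ cong (D + weighted S (d⁺ S) +_) (sum-cong-≗ (λ v → 𝟙-idem (S v))) ⟨
    D + weighted S (d⁺ S) + weighted S (λ v → 𝟙 (S v))
      ≡⟨ cong (_+ weighted S (λ v → 𝟙 (S v))) (weighted-+ S (d⁻ S) (d⁺ S)) ⟨
    weighted S (λ v → d⁻ S v + d⁺ S v) + weighted S (λ v → 𝟙 (S v))
      ≡⟨ weighted-+ S (λ v → d⁻ S v + d⁺ S v) (λ v → 𝟙 (S v)) ⟨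
    weighted S (λ v → d⁻ S v + d⁺ S v + 𝟙 (S v))
      ≡⟨ sum-cong-≗ (λ v → cong (𝟙 (S v) *_) (d⁻+d⁺ S v)) ⟩
    weighted S (λ _ → count S)
      ≡⟨ sum-restrict-const S (count S) ⟩
    count S * count S ∎
    where
    open ≡-Reasoning
    D = weighted S (d⁻ S)
    𝟙-idem : ∀ a → 𝟙 a * 𝟙 a ≡ 𝟙 a
    𝟙-idem true  = refl
    𝟙-idem false = refl

  weighted-*ˡ : ∀ S c f → weighted S (λ v → c * f v) ≡ c * weighted S f
  weighted-*ˡ S c f = trans (sum-cong-≗ (λ v → x*[y*z]≡y*[x*z] (𝟙 (S v)) c (f v)))
    (sym (*-distribˡ-sum c (λ v → 𝟙 (S v) * f v)))
    where
    x*[y*z]≡y*[x*z] : ∀ x y z → x * (y * z) ≡ y * (x * z)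
    x*[y*z]≡y*[x*z] x y z =
      trans (sym (*-assoc x y z)) (trans (cong (_* z) (*-comm x y)) (*-assoc y x z))

  ∃-d⁻-≤-half : ∀ S → 1 ≤ count S → ∃ λ v → S v ≡ true × 2 * d⁻ S v + 1 ≤ count S
  ∃-d⁻-≤-half S 1≤s with Fin.any? (λ v → (S v Bool.≟ true) ×-dec (2 * d⁻ S v + 1 ≤? count S))
  ... | yes (v , Sv , small) = v , Sv , small
  ... | no none = ⊥-elim (<⇒≱ 1≤s (+-cancelʳ-≤ (s * s) s 0 s+s*s≤s*s))
    where
    s = count S
    s≤2d : ∀ v → S v ≡ true → s ≤ 2 * d⁻ S v
    s≤2d v Sv = ≤-pred (≤-trans (≰⇒> (λ small → none (v , Sv , small)))
                               (≤-reflexive (+-comm (2 * d⁻ S v) 1)))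
    s+s*s≤s*s : s + s * s ≤ s * s
    s+s*s≤s*s = begin
      s + s * s                         ≡⟨ +-comm s (s * s) ⟩
      s * s + s                         ≡⟨ cong (_+ s) (sum-restrict-const S s) ⟨
      weighted S (λ _ → s) + s          ≤⟨ +-monoˡ-≤ s (sum-restrict-mono S s≤2d) ⟩
      weighted S (λ v → 2 * d⁻ S v) + s ≡⟨ cong (_+ s) (weighted-*ˡ S 2 (d⁻ S)) ⟩
      2 * weighted S (d⁻ S) + s         ≡⟨ handshake S ⟩
      s * s                             ∎
      where open ≤-Reasoning

  ∃-d⁻-≥-half : ∀ S → 1 ≤ count S → ∃ λ v → S v ≡ true × count S ≤ 2 * d⁻ S v + 1
  ∃-d⁻-≥-half S 1≤s with Fin.any? (λ v → (S v Bool.≟ true) ×-dec (count S ≤? 2 * d⁻ S v + 1))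
  ... | yes (v , Sv , large) = v , Sv , large
  ... | no none = ⊥-elim (<⇒≱ 1≤s (+-cancelˡ-≤ (2 * D + s) s 0 2D+s+s≤2D+s+0))
    where
    s = count S
    D = weighted S (d⁻ S)
    2d+2≤s : ∀ v → S v ≡ true → 2 * d⁻ S v + 2 ≤ s
    2d+2≤s v Sv = ≤-trans (≤-reflexive (+-suc (2 * d⁻ S v) 1))
                          (≰⇒> (λ large → none (v , Sv , large)))
    2D+s+s≤2D+s+0 : 2 * D + s + s ≤ 2 * D + s + 0
    2D+s+s≤2D+s+0 = begin
      2 * D + s + s
        ≡⟨ +-assoc (2 * D) s s ⟩
      2 * D + (s + s)
        ≡⟨ cong (2 * D +_) (trans (*-comm s 2) (cong (s +_) (+-identityʳ s))) ⟨
      2 * D + s * 2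
        ≡⟨ cong₂ _+_ (weighted-*ˡ S 2 (d⁻ S)) (sum-restrict-const S 2) ⟨
      weighted S (λ v → 2 * d⁻ S v) + weighted S (λ _ → 2)
        ≡⟨ weighted-+ S (λ v → 2 * d⁻ S v) (λ _ → 2) ⟨
      weighted S (λ v → 2 * d⁻ S v + 2)
        ≤⟨ sum-restrict-mono S 2d+2≤s ⟩
      weighted S (λ _ → s)
        ≡⟨ sum-restrict-const S s ⟩
      s * s
        ≡⟨ handshake S ⟨
      2 * D + s
        ≡⟨ +-identityʳ (2 * D + s) ⟨
      2 * D + s + 0 ∎
      where open ≤-Reasoning

  few-small-indegrees : ∀ S Lo τ → 1 ≤ τ → (∀ z → Lo z ≡ true → S z ≡ true × d⁻ S z < τ) →
    count Lo + 1 ≤ 2 * τ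
  few-small-indegrees S Lo τ 1≤τ small with 1 ≤? count Lo
  ... | no ∣Lo∣<1 = ≤-trans (≤-trans (≤-reflexive (+-comm (count Lo) 1)) (≰⇒> ∣Lo∣<1))
                            (≤-trans 1≤τ (m≤m+n τ (τ + 0)))
  ... | yes 1≤∣Lo∣ with ∃-d⁻-≥-half Lo 1≤∣Lo∣
  ...   | v , Lo-v , ∣Lo∣≤2d+1 = begin
    count Lo + 1        ≤⟨ +-monoˡ-≤ 1 ∣Lo∣≤2d+1 ⟩
    2 * d⁻ Lo v + 1 + 1 ≡⟨ trans (+-assoc (2 * d⁻ Lo v) 1 1) (sym (*-distribˡ-+ 2 (d⁻ Lo v) 1)) ⟩
    2 * (d⁻ Lo v + 1)   ≤⟨ *-monoʳ-≤ 2 (≤-trans (+-monoˡ-≤ 1 d⁻-Lo≤d⁻-S) d⁻-S+1≤τ) ⟩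
    2 * τ               ∎
    where
    open ≤-Reasoning
    d⁻-Lo≤d⁻-S : d⁻ Lo v ≤ d⁻ S v
    d⁻-Lo≤d⁻-S = count-mono (λ u Lo-u∧Auv → let (Lo-u , Auv) = ∧-elim Lo-u∧Auv in
                                           ∧-intro (proj₁ (small u Lo-u)) Auv)
    d⁻-S+1≤τ : d⁻ S v + 1 ≤ τ
    d⁻-S+1≤τ = ≤-trans (≤-reflexive (+-comm (d⁻ S v) 1)) (proj₂ (small v Lo-v))

-- Vertices of large out-degree

module _ {n : ℕ} (T : Tournament n) where

  isLarge : Fin n → Bool
  isLarge v = 25 * ∣ tabulate (λ u → outdeg T v <ᵇ outdeg T u) ∣ <ᵇ n

  isLarge⇒LargeOutdeg : ∀ v → isLarge v ≡ true → LargeOutdeg T v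
  isLarge⇒LargeOutdeg v = <ᵇ≡true⇒< _ n

  private
    atLeast : ℕ → Fin n → Bool
    atLeast d u = d ≤ᵇ outdeg T u

    Many : ℕ → Set
    Many d = n ≤ 25 * count (atLeast d)

  -- For a threshold d met by at least |T|/25 vertices while d + 1 is not, every vertex of
  -- out-degree at least d has fewer than |T|/25 vertices of larger out-degree.
  many-large-outdegree : 1 ≤ n → n ≤ 25 * count isLarge
  many-large-outdegree 1≤n
    with ∃-crossing {P = Many} (λ d → n ≤? 25 * count (atLeast d)) many-0 (suc n) few-n+1
    where
    many-0 : Many 0
    many-0 = ≤-trans (m≤n*m n 25) (≤-reflexive (cong (25 *_) (sym (count-true {n}))))
    few-n+1 : ¬ Many (suc n)
    few-n+1 many = <⇒≱ 1≤n (≤-trans many (≤-reflexive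
      (trans (cong (25 *_) (trans (count-cong none) (count-false {n}))) (*-zeroʳ 25))))
      where
      none : ∀ u → atLeast (suc n) u ≡ false
      none u with suc n ≤ᵇ outdeg T u in e
      ... | false = refl
      ... | true  = ⊥-elim (<⇒≱ (≤ᵇ≡true⇒≤ (suc n) (outdeg T u) e) (Subset.∣p∣≤n (outNbhd T u)))
  ... | d , many-d , ¬many-d+1 = ≤-trans many-d (*-monoʳ-≤ 25 (count-mono atLeast-d⇒isLarge))
    where
    atLeast-d⇒isLarge : ∀ u → atLeast d u ≡ true → isLarge u ≡ true
    atLeast-d⇒isLarge u d≤ᵇu = <⇒<ᵇ≡true (≤-<-trans (*-monoʳ-≤ 25 beaters≤) (≰⇒> ¬many-d+1))
      where
      beaters≤ : ∣ tabulate (λ w → outdeg T u <ᵇ outdeg T w) ∣ ≤ count (atLeast (suc d))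
      beaters≤ = ≤-trans (≤-reflexive (∣tabulate∣≡count (λ w → outdeg T u <ᵇ outdeg T w)))
        (count-mono {S′ = atLeast (suc d)} (λ w u<ᵇw →
        ≤⇒≤ᵇ≡true (≤-trans (s≤s (≤ᵇ≡true⇒≤ d (outdeg T u) d≤ᵇu))
                            (<ᵇ≡true⇒< (outdeg T u) (outdeg T w) u<ᵇw))))

-- Transitive chains

_∈ᵇ_ : ∀ {n} → Fin n → List (Fin n) → Bool
x ∈ᵇ []       = false
x ∈ᵇ (y ∷ ys) = (x == y) ∨ (x ∈ᵇ ys)

module _ {n : ℕ} where

  ∈ᵇ-here : ∀ (x : Fin n) xs → x ∈ᵇ (x ∷ xs) ≡ true
  ∈ᵇ-here x xs rewrite ==-refl x = refl

  ∈ᵇ-there : ∀ {x : Fin n} y xs → x ∈ᵇ xs ≡ true → x ∈ᵇ (y ∷ xs) ≡ true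
  ∈ᵇ-there {x} y _ = ∨-introʳ (x == y)

  ∃-∈ᵇ : ∀ (xs : List (Fin n)) {k} → length xs ≡ suc k → ∃ λ x → x ∈ᵇ xs ≡ true
  ∃-∈ᵇ (x ∷ xs) _ = x , ∈ᵇ-here x xs

  ∈ᵇ-∷⁻ : ∀ {x : Fin n} y xs → x ∈ᵇ (y ∷ xs) ≡ true → x ≡ y ⊎ x ∈ᵇ xs ≡ true
  ∈ᵇ-∷⁻ y xs x∈ with ∨-elim x∈
  ... | inj₁ x==y = inj₁ (==⇒≡ x==y)
  ... | inj₂ x∈xs = inj₂ x∈xs

  ∈ᵇ-++ : ∀ (x : Fin n) xs ys → x ∈ᵇ (xs ++ ys) ≡ (x ∈ᵇ xs ∨ x ∈ᵇ ys)
  ∈ᵇ-++ x []       ys = refl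
  ∈ᵇ-++ x (y ∷ xs) ys rewrite ∈ᵇ-++ x xs ys = sym (∨-assoc (x == y) (x ∈ᵇ xs) (x ∈ᵇ ys))

  ∈ᵇ-++⁺ˡ : ∀ {x : Fin n} xs ys → x ∈ᵇ xs ≡ true → x ∈ᵇ (xs ++ ys) ≡ true
  ∈ᵇ-++⁺ˡ {x} xs ys x∈ rewrite ∈ᵇ-++ x xs ys = ∨-introˡ (x ∈ᵇ ys) x∈

  ∈ᵇ-++⁺ʳ : ∀ {x : Fin n} xs ys → x ∈ᵇ ys ≡ true → x ∈ᵇ (xs ++ ys) ≡ true
  ∈ᵇ-++⁺ʳ {x} xs ys x∈ rewrite ∈ᵇ-++ x xs ys = ∨-introʳ (x ∈ᵇ xs) x∈

  ∈ᵇ-++⁻ : ∀ {x : Fin n} xs ys → x ∈ᵇ (xs ++ ys) ≡ true → x ∈ᵇ xs ≡ true ⊎ x ∈ᵇ ys ≡ true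
  ∈ᵇ-++⁻ {x} xs ys x∈ rewrite ∈ᵇ-++ x xs ys = ∨-elim x∈

  ∈ᵇ-lookup : ∀ (xs : List (Fin n)) i → lookup xs i ∈ᵇ xs ≡ true
  ∈ᵇ-lookup (x ∷ xs) zero    = ∈ᵇ-here x xs
  ∈ᵇ-lookup (x ∷ xs) (suc i) = ∈ᵇ-there x xs (∈ᵇ-lookup xs i)

  ∈ᵇ⇒∃-lookup : ∀ (xs : List (Fin n)) x → x ∈ᵇ xs ≡ true → ∃ λ i → lookup xs i ≡ x
  ∈ᵇ⇒∃-lookup (y ∷ xs) x x∈ with ∈ᵇ-∷⁻ {x} y xs x∈
  ... | inj₁ refl = zero , refl
  ... | inj₂ x∈xs = let (i , xsᵢ≡x) = ∈ᵇ⇒∃-lookup xs x x∈xs in suc i , xsᵢ≡x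

  lookup-last-∈ᵇ : ∀ (x : Fin n) xs y ys →
    lookup (x ∷ xs ++ y ∷ ys) (fromℕ (length (xs ++ y ∷ ys))) ∈ᵇ (y ∷ ys) ≡ true
  lookup-last-∈ᵇ x []       y ys = ∈ᵇ-lookup (y ∷ ys) (fromℕ (length ys))
  lookup-last-∈ᵇ x (z ∷ xs) y ys = lookup-last-∈ᵇ z xs y ys

module _ {n : ℕ} (T : Tournament n) where

  private
    A = adj T

  -- The list x₀ x₁ … x_k with x_j → x_i whenever i < j: a transitive subtournament listed
  -- from its head to its tail.
  Chain : List (Fin n) → Set
  Chain []       = ⊤
  Chain (x ∷ xs) = (∀ y → y ∈ᵇ xs ≡ true → A y x ≡ true) × Chain xs

  beatsAll : List (Fin n) → Fin n → Bool
  beatsAll []       z = true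
  beatsAll (y ∷ ys) z = A z y ∧ beatsAll ys z

  Chain-++⁻ˡ : ∀ xs ys → Chain (xs ++ ys) → Chain xs
  Chain-++⁻ˡ []       ys _           = tt
  Chain-++⁻ˡ (x ∷ xs) ys (x← , chain) = (λ y y∈ → x← y (∈ᵇ-++⁺ˡ xs ys y∈)) , Chain-++⁻ˡ xs ys chain

  Chain-++⁻ʳ : ∀ xs ys → Chain (xs ++ ys) → Chain ys
  Chain-++⁻ʳ []       ys chain       = chain
  Chain-++⁻ʳ (x ∷ xs) ys (_ , chain) = Chain-++⁻ʳ xs ys chain

  Chain-++⇒beats : ∀ xs ys → Chain (xs ++ ys) → ∀ x y → x ∈ᵇ xs ≡ true → y ∈ᵇ ys ≡ true → A y x ≡ true
  Chain-++⇒beats (z ∷ xs) ys (z← , chain) x y x∈ y∈ with ∈ᵇ-∷⁻ {x = x} z xs x∈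
  ... | inj₁ refl  = z← y (∈ᵇ-++⁺ʳ xs ys y∈)
  ... | inj₂ x∈xs = Chain-++⇒beats xs ys chain x y x∈xs y∈

  Chain-++⁺ : ∀ xs ys → Chain xs → Chain ys →
    (∀ x y → x ∈ᵇ xs ≡ true → y ∈ᵇ ys ≡ true → A y x ≡ true) → Chain (xs ++ ys)
  Chain-++⁺ []       ys _            chain-ys _     = chain-ys
  Chain-++⁺ (x ∷ xs) ys (x← , chain) chain-ys beats =
    x←′ , Chain-++⁺ xs ys chain chain-ys (λ a b a∈ b∈ → beats a b (∈ᵇ-there x xs a∈) b∈)
    where
    x←′ : ∀ y → y ∈ᵇ (xs ++ ys) ≡ true → A y x ≡ true
    x←′ y y∈ with ∈ᵇ-++⁻ {x = y} xs ys y∈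
    ... | inj₁ y∈xs = x← y y∈xs
    ... | inj₂ y∈ys = beats x y (∈ᵇ-here x xs) y∈ys

  Chain-++-disjoint : ∀ xs ys → Chain (xs ++ ys) → ∀ x → x ∈ᵇ xs ≡ true → x ∈ᵇ ys ≡ false
  Chain-++-disjoint xs ys chain x x∈xs with x ∈ᵇ ys in x∈ys
  ... | false = refl
  ... | true  = ⊥-elim (true≢false (Chain-++⇒beats xs ys chain x x x∈xs x∈ys) (irrefl T x))

  count-∈ᵇ : ∀ xs → Chain xs → count (_∈ᵇ xs) ≡ length xs
  count-∈ᵇ []       _            = count-false {n}
  count-∈ᵇ (x ∷ xs) (x← , chain) =
    trans (count-∨-disjoint (_== x) (_∈ᵇ xs) x∉xs) (cong₂ _+_ (count-== x) (count-∈ᵇ xs chain))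
    where
    x∉xs : ∀ z → z == x ≡ true → z ∈ᵇ xs ≡ false
    x∉xs z z==x = subst (λ w → w ∈ᵇ xs ≡ false) (sym (==⇒≡ z==x)) x-fresh
      where
      x-fresh : x ∈ᵇ xs ≡ false
      x-fresh with x ∈ᵇ xs in x∈xs
      ... | false = refl
      ... | true  = ⊥-elim (true≢false (x← x x∈xs) (irrefl T x))

  Chain-lookup : ∀ xs → Chain xs → ∀ i j → toℕ i < toℕ j → A (lookup xs j) (lookup xs i) ≡ true
  Chain-lookup (x ∷ xs) (x← , _)     zero    (suc j) _         = x← (lookup xs j) (∈ᵇ-lookup xs j)
  Chain-lookup (x ∷ xs) (_ , chain) (suc i) (suc j) (s≤s i<j) = Chain-lookup xs chain i j i<j

  Chain-lookup-injective : ∀ xs → Chain xs → ∀ i j → lookup xs i ≡ lookup xs j → i ≡ j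
  Chain-lookup-injective xs chain i j xsᵢ≡xsⱼ with Fin.<-cmp i j
  ... | tri≈ _ i≡j _ = i≡j
  ... | tri< i<j _ _ = ⊥-elim (true≢false
        (subst (λ z → A z (lookup xs i) ≡ true) (sym xsᵢ≡xsⱼ) (Chain-lookup xs chain i j i<j))
        (irrefl T (lookup xs i)))
  ... | tri> _ _ j<i = ⊥-elim (true≢false
        (subst (λ z → A z (lookup xs j) ≡ true) xsᵢ≡xsⱼ (Chain-lookup xs chain j i j<i))
        (irrefl T (lookup xs j)))

  -- The enumeration required by TransitiveHT runs from tail to head, so it reads the chain
  -- backwards.
  Chain⇒TransitiveHeadTail : ∀ xs ys → 1 ≤ length xs → 1 ≤ length ys → Chain (xs ++ ys) →
    TransitiveHeadTail T (tabulate (_∈ᵇ xs)) (tabulate (_∈ᵇ ys))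
  Chain⇒TransitiveHeadTail (x ∷ xs) (y ∷ ys) _ _ chain =
    ord (fromℕ k) , ord zero , head∈ , tail∈ ,
    k , ord , ord-injective , ord-surjective , ord∈ , ord-edges , refl , refl
    where
    l = x ∷ xs ++ y ∷ ys
    k = length (xs ++ y ∷ ys)
    ord : Fin (suc k) → Fin n
    ord a = lookup l (opposite a)
    ∈ᵇl⇒∈∪ : ∀ z → z ∈ᵇ l ≡ true → z ∈ (tabulate (_∈ᵇ (x ∷ xs)) ∪ tabulate (_∈ᵇ (y ∷ ys)))
    ∈ᵇl⇒∈∪ z z∈ with ∈ᵇ-++⁻ {x = z} (x ∷ xs) (y ∷ ys) z∈
    ... | inj₁ z∈xs = Subset.x∈p∪q⁺ (inj₁ (∈-tabulate⁺ z∈xs))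
    ... | inj₂ z∈ys = Subset.x∈p∪q⁺ (inj₂ (∈-tabulate⁺ z∈ys))
    opposite-fromℕ : opposite (fromℕ k) ≡ zero
    opposite-fromℕ = Fin.toℕ-injective
      (trans (Fin.opposite-prop (fromℕ k)) (trans (cong (k ∸_) (Fin.toℕ-fromℕ k)) (n∸n≡0 k)))
    head∈ : ord (fromℕ k) ∈ tabulate (_∈ᵇ (x ∷ xs))
    head∈ rewrite opposite-fromℕ = ∈-tabulate⁺ (∈ᵇ-here x xs)
    tail∈ : ord zero ∈ tabulate (_∈ᵇ (y ∷ ys))
    tail∈ = ∈-tabulate⁺ (lookup-last-∈ᵇ x xs y ys)
    ord-injective : ∀ {a b} → ord a ≡ ord b → a ≡ b
    ord-injective {a} {b} e = trans (sym (Fin.opposite-involutive a))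
      (trans (cong opposite (Chain-lookup-injective l chain (opposite a) (opposite b) e))
             (Fin.opposite-involutive b))
    ord-surjective : ∀ z → z ∈ (tabulate (_∈ᵇ (x ∷ xs)) ∪ tabulate (_∈ᵇ (y ∷ ys))) → ∃ λ a → ord a ≡ z
    ord-surjective z z∈ = opposite i , trans (cong (lookup l) (Fin.opposite-involutive i)) lᵢ≡z
      where
      z∈l : z ∈ᵇ l ≡ true
      z∈l with Subset.x∈p∪q⁻ (tabulate (_∈ᵇ (x ∷ xs))) (tabulate (_∈ᵇ (y ∷ ys))) z∈
      ... | inj₁ z∈xs = ∈ᵇ-++⁺ˡ (x ∷ xs) (y ∷ ys) (∈-tabulate⁻ z∈xs)
      ... | inj₂ z∈ys = ∈ᵇ-++⁺ʳ (x ∷ xs) (y ∷ ys) (∈-tabulate⁻ z∈ys)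
      i = proj₁ (∈ᵇ⇒∃-lookup l z z∈l)
      lᵢ≡z = proj₂ (∈ᵇ⇒∃-lookup l z z∈l)
    ord∈ : ∀ a → ord a ∈ (tabulate (_∈ᵇ (x ∷ xs)) ∪ tabulate (_∈ᵇ (y ∷ ys)))
    ord∈ a = ∈ᵇl⇒∈∪ (ord a) (∈ᵇ-lookup l (opposite a))
    ord-edges : ∀ a b → a Fin.< b → A (ord a) (ord b) ≡ true
    ord-edges a b a<b = Chain-lookup l chain (opposite b) (opposite a) opp-b<opp-a
      where
      opp-b<opp-a : toℕ (opposite b) < toℕ (opposite a)
      opp-b<opp-a rewrite Fin.opposite-prop a | Fin.opposite-prop b =
        ∸-monoʳ-< a<b (≤-pred (Fin.toℕ<n b))

  beatsAll-++⁻ʳ : ∀ xs ys z → beatsAll (xs ++ ys) z ≡ true → beatsAll ys z ≡ true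
  beatsAll-++⁻ʳ []       ys z beats = beats
  beatsAll-++⁻ʳ (x ∷ xs) ys z beats = beatsAll-++⁻ʳ xs ys z (proj₂ (∧-elim beats))

  beatsAll-∈ᵇ : ∀ xs z y → beatsAll xs z ≡ true → y ∈ᵇ xs ≡ true → A z y ≡ true
  beatsAll-∈ᵇ (x ∷ xs) z y beats y∈ with ∈ᵇ-∷⁻ {x = y} x xs y∈
  ... | inj₁ refl  = proj₁ (∧-elim beats)
  ... | inj₂ y∈xs = beatsAll-∈ᵇ xs z y (proj₂ (∧-elim {A z x} beats)) y∈xs

  beatsAll-false : ∀ xs z → beatsAll xs z ≡ false → ∃ λ y → y ∈ᵇ xs ≡ true × A z y ≡ false
  beatsAll-false (x ∷ xs) z ¬beats with A z x in Azx
  ... | false = x , ∈ᵇ-here x xs , Azx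
  ... | true  = let (y , y∈ , Azy) = beatsAll-false xs z ¬beats in y , ∈ᵇ-there x xs y∈ , Azy

  beatsAll⇒∉ : ∀ xs z → beatsAll xs z ≡ true → z ∈ᵇ xs ≡ false
  beatsAll⇒∉ xs z beats with z ∈ᵇ xs in z∈
  ... | false = refl
  ... | true  = ⊥-elim (true≢false (beatsAll-∈ᵇ xs z z beats z∈) (irrefl T z))

  -- Each step moves into the in-neighbourhood of a vertex of in-degree at least (|S| - 1)/2,
  -- losing at most half of the set.
  chain-with-common-dominators : ∀ t c S → 1 ≤ c → 2 ^ t * c ≤ count S →
    Σ (List (Fin n)) λ l → length l ≡ t × Chain l × (∀ x → x ∈ᵇ l ≡ true → S x ≡ true)
      × c ≤ count (λ z → S z ∧ beatsAll l z)
  chain-with-common-dominators zero c S _ c+0≤∣S∣ =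
    [] , refl , tt , (λ _ ()) ,
    ≤-trans (≤-trans (≤-reflexive (sym (+-identityʳ c))) c+0≤∣S∣)
            (≤-reflexive (count-cong (λ z → sym (∧-identityʳ (S z)))))
  chain-with-common-dominators (suc t) c S 1≤c 2ᵗ⁺¹c≤∣S∣
    with ∃-d⁻-≥-half T S (≤-trans (*-mono-≤ (m^n>0 2 (suc t)) 1≤c) 2ᵗ⁺¹c≤∣S∣)
  ... | v , Sv , ∣S∣≤2d+1
    with chain-with-common-dominators t c (in-neighbours T S v) 1≤c
           (2*m≤2*n+1⇒m≤n _ _ (≤-trans (≤-reflexive (sym (*-assoc 2 (2 ^ t) c)))
                                       (≤-trans 2ᵗ⁺¹c≤∣S∣ ∣S∣≤2d+1)))
  ... | l , refl , chain , l⊆ , c≤dominators =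
    v ∷ l , refl , ((λ y y∈ → proj₂ (∧-elim (l⊆ y y∈))) , chain) , v∷l⊆S ,
    ≤-trans c≤dominators (≤-reflexive (count-cong (λ z → ∧-assoc (S z) (A z v) (beatsAll l z))))
    where
    v∷l⊆S : ∀ x → x ∈ᵇ (v ∷ l) ≡ true → S x ≡ true
    v∷l⊆S x x∈ with ∈ᵇ-∷⁻ {x = x} v l x∈
    ... | inj₁ refl = Sv
    ... | inj₂ x∈l  = proj₁ (∧-elim (l⊆ x x∈l))

  chain-of-length : ∀ k S → 2 ^ k ≤ count S →
    Σ (List (Fin n)) λ l → length l ≡ suc k × Chain l × (∀ x → x ∈ᵇ l ≡ true → S x ≡ true)
  chain-of-length k S 2ᵏ≤∣S∣
    with chain-with-common-dominators k 1 S ≤-refl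
           (≤-trans (≤-reflexive (*-identityʳ (2 ^ k))) 2ᵏ≤∣S∣)
  ... | l , refl , chain , l⊆ , 1≤dominators with count-nonempty _ 1≤dominators
  ...   | z , Sz∧beats =
    l ++ [ z ] , trans (length-++ l) (+-comm (length l) 1) ,
    Chain-++⁺ l [ z ] chain ((λ _ ()) , tt) (λ x y x∈ y∈ → z-beats x y x∈ y∈) , l++z⊆S
    where
    z-beats : ∀ x y → x ∈ᵇ l ≡ true → y ∈ᵇ [ z ] ≡ true → A y x ≡ true
    z-beats x y x∈ y∈ with ∈ᵇ-∷⁻ {x = y} z [] y∈
    ... | inj₁ refl = beatsAll-∈ᵇ l z x (proj₂ (∧-elim Sz∧beats)) x∈
    l++z⊆S : ∀ x → x ∈ᵇ (l ++ [ z ]) ≡ true → S x ≡ true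
    l++z⊆S x x∈ with ∈ᵇ-++⁻ {x = x} l [ z ] x∈
    ... | inj₁ x∈l = l⊆ x x∈l
    ... | inj₂ x∈z with ∈ᵇ-∷⁻ {x = x} z [] x∈z
    ...   | inj₁ refl = proj₁ (∧-elim Sz∧beats)

splitAt-length : ∀ {X : Set} a b (l : List X) → length l ≡ a + b →
  Σ (List X) λ l₁ → Σ (List X) λ l₂ → l ≡ l₁ ++ l₂ × length l₁ ≡ a × length l₂ ≡ b
splitAt-length a b l ∣l∣≡a+b =
  take a l , drop a l , sym (take++drop≡id a l) ,
  trans (length-take a l) (trans (cong (a ⊓_) ∣l∣≡a+b) (m≤n⇒m⊓n≡m (m≤m+n a b))) ,
  trans (length-drop a l) (trans (cong (_∸ a) ∣l∣≡a+b) (m+n∸m≡n a b))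

-- The parts B³ and B⁴

module _ {n : ℕ} (T : Tournament n) where

  private
    A = adj T

  -- Nothing is required for r = 0, where E is the whole of S.
  InDegreeBound : ℕ → (S X E : Fin n → Bool) → Set
  InDegreeBound zero    S X E = ⊤
  InDegreeBound (suc r) S X E =
    ∀ u → E u ≡ true → 2 ^ r * count E ≤ count (λ z → (S z ∧ not (X z)) ∧ A z u)

  -- The parts B³ (of length r) and B⁴ of an outdominator inside S, with the exceptional
  -- vertices X and the set E that becomes E⁺.
  record LowerPart (M′ r : ℕ) (S : Fin n → Bool) : Set where
    field
      b3 b4          : List (Fin n)
      length-b3      : length b3 ≡ r
      length-b4      : length b4 ≡ suc M′
      chain          : Chain T (b3 ++ b4)
      b3b4⊆S         : ∀ x → x ∈ᵇ (b3 ++ b4) ≡ true → S x ≡ true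
      X E            : Fin n → Bool
      X⊆S            : ∀ x → X x ≡ true → S x ≡ true
      E⊆S            : ∀ x → E x ≡ true → S x ≡ true
      E∩X≡∅          : ∀ x → E x ≡ true → X x ≡ false
      ∣X∣≤           : count X ≤ 2 * 2 ^ (r + M′)
      ∣E∣+∣X∣≤∣S∣    : 2 ^ r * count E + count X ≤ count S
      b3-dominates   : ∀ v → S v ≡ true → X v ≡ false → v ∈ᵇ (b3 ++ b4) ≡ false → E v ≡ false →
                       ∃ λ w → w ∈ᵇ b3 ≡ true × A w v ≡ true
      indegree-bound : InDegreeBound r S X E

  lowerPart-zero : ∀ M′ S → 2 ^ M′ ≤ count S → LowerPart M′ 0 S
  lowerPart-zero M′ S 2^M′≤∣S∣ with chain-of-length T M′ S 2^M′≤∣S∣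
  ... | b4 , ∣b4∣ , chain , b4⊆S = record
    { b3 = [] ; b4 = b4 ; length-b3 = refl ; length-b4 = ∣b4∣ ; chain = chain ; b3b4⊆S = b4⊆S
    ; X = λ _ → false ; E = S
    ; X⊆S = λ _ () ; E⊆S = λ _ Sx → Sx ; E∩X≡∅ = λ _ _ → refl
    ; ∣X∣≤ = ≤-trans (≤-reflexive (count-false {n})) z≤n
    ; ∣E∣+∣X∣≤∣S∣ = ≤-reflexive (trans (cong₂ _+_ (+-identityʳ (count S)) (count-false {n}))
                                       (+-identityʳ (count S)))
    ; b3-dominates = λ _ Sv _ _ ¬Ev → ⊥-elim (true≢false Sv ¬Ev)
    ; indegree-bound = tt
    }

  -- A vertex v of in-degree between τ and 3τ closes B³: the rest of B³ and all of B⁴ are taken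
  -- inside its in-neighbourhood, which becomes exceptional, and v beats every other vertex.
  lowerPart-middle : ∀ M′ r S v → S v ≡ true →
    2 ^ (r + M′) ≤ d⁻ T S v → d⁻ T S v ≤ 3 * 2 ^ (r + M′) → LowerPart M′ (suc r) S
  lowerPart-middle M′ r S v Sv τ≤d d≤3τ with chain-of-length T (r + M′) (in-neighbours T S v) τ≤d
  ... | l , ∣l∣ , chain , l⊆N with splitAt-length r (suc M′) l (trans ∣l∣ (sym (+-suc r M′)))
  ... | b3 , b4 , refl , ∣b3∣ , ∣b4∣ = record
    { b3 = v ∷ b3 ; b4 = b4 ; length-b3 = cong suc ∣b3∣ ; length-b4 = ∣b4∣
    ; chain = (λ y y∈ → proj₂ (∧-elim (l⊆N y y∈))) , chain
    ; b3b4⊆S = v∷b3b4⊆S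
    ; X = N ; E = λ _ → false
    ; X⊆S = λ _ Nx → proj₁ (∧-elim Nx) ; E⊆S = λ _ () ; E∩X≡∅ = λ _ ()
    ; ∣X∣≤ = ≤-trans d≤3τ (≤-trans (*-monoˡ-≤ τ {3} {4} (s≤s (s≤s (s≤s z≤n))))
                                  (≤-reflexive (*-assoc 2 2 τ)))
    ; ∣E∣+∣X∣≤∣S∣ = ≤-trans (≤-reflexive (cong (_+ count N)
                              (trans (cong (2 ^ suc r *_) (count-false {n})) (*-zeroʳ (2 ^ suc r)))))
                           (count-mono {S = N} {S′ = S} (λ _ Nx → proj₁ (∧-elim Nx)))
    ; b3-dominates = v-dominates
    ; indegree-bound = λ _ ()
    }
    where
    τ = 2 ^ (r + M′)
    N : Fin n → Bool
    N = in-neighbours T S v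
    v∷b3b4⊆S : ∀ x → x ∈ᵇ (v ∷ b3 ++ b4) ≡ true → S x ≡ true
    v∷b3b4⊆S x x∈ with ∈ᵇ-∷⁻ {x = x} v (b3 ++ b4) x∈
    ... | inj₁ refl = Sv
    ... | inj₂ x∈l  = proj₁ (∧-elim (l⊆N x x∈l))
    v-dominates : ∀ u → S u ≡ true → N u ≡ false → u ∈ᵇ (v ∷ b3 ++ b4) ≡ false → false ≡ false →
      ∃ λ w → w ∈ᵇ (v ∷ b3) ≡ true × A w u ≡ true
    v-dominates u Su ¬Nu u∉ _ = v , ∈ᵇ-here v b3 , adj-flip T u v u≢v (∧-falseʳ Su ¬Nu)
      where
      u≢v : u ≢ v
      u≢v refl = true≢false (∈ᵇ-here v (b3 ++ b4)) u∉

  -- Without a vertex of in-degree in [τ, 3τ], the vertices of in-degree below τ are fewer than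
  -- 2τ and become exceptional; every other vertex keeps in-degree at least τ among the others,
  -- and the one of least such in-degree, w, joins B³. Its in-neighbourhood S″ there has at
  -- most half of them and at least τ vertices, and the rest of the lower part is built in S″.
  module Step (M′ r : ℕ) (S : Fin n → Bool)
    (no-middle : ¬ (∃ λ v → S v ≡ true × 2 ^ (r + M′) ≤ d⁻ T S v × d⁻ T S v ≤ 3 * 2 ^ (r + M′)))
    (large : 2 ^ (suc r + M′) ≤ count S) where

    τ : ℕ
    τ = 2 ^ (r + M′)

    small Lo S′ : Fin n → Bool
    small z = d⁻ T S z <ᵇ τ
    Lo z = S z ∧ small z
    S′ z = S z ∧ not (small z)

    ∣Lo∣+1≤2τ : count Lo + 1 ≤ 2 * τ
    ∣Lo∣+1≤2τ = few-small-indegrees T S Lo τ (m^n>0 2 (r + M′))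
      (λ z Lo-z → proj₁ (∧-elim Lo-z) , <ᵇ≡true⇒< (d⁻ T S z) τ (proj₂ (∧-elim {S z} Lo-z)))

    S′⇒S : ∀ z → S′ z ≡ true → S z ≡ true
    S′⇒S z S′z = proj₁ (∧-elim S′z)

    S′⇒¬Lo : ∀ z → S′ z ≡ true → Lo z ≡ false
    S′⇒¬Lo z S′z rewrite not-false (proj₂ (∧-elim {S z} S′z)) = ∧-zeroʳ (S z)

    S′⇒3τ<d⁻ : ∀ z → S′ z ≡ true → 3 * τ < d⁻ T S z
    S′⇒3τ<d⁻ z S′z = ≰⇒> (λ d≤3τ → no-middle (z , S′⇒S z S′z , τ≤d , d≤3τ))
      where
      τ≤d : τ ≤ d⁻ T S z
      τ≤d = <ᵇ≡false⇒≥ (not-false (proj₂ (∧-elim {S z} S′z)))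

    d⁻-S≤d⁻-S′+∣Lo∣ : ∀ z → d⁻ T S z ≤ d⁻ T S′ z + count Lo
    d⁻-S≤d⁻-S′+∣Lo∣ z = begin
      d⁻ T S z
        ≡⟨ count-split (λ u → S u ∧ A u z) small ⟩
      count (λ u → (S u ∧ A u z) ∧ small u) + count (λ u → (S u ∧ A u z) ∧ not (small u))
        ≤⟨ +-mono-≤ (count-mono into-Lo) (count-mono into-S′) ⟩
      count Lo + d⁻ T S′ z
        ≡⟨ +-comm (count Lo) (d⁻ T S′ z) ⟩
      d⁻ T S′ z + count Lo ∎
      where
      open ≤-Reasoning
      into-Lo : ∀ u → (S u ∧ A u z) ∧ small u ≡ true → Lo u ≡ true
      into-Lo u e = let (SA , sm) = ∧-elim {S u ∧ A u z} e in ∧-intro (proj₁ (∧-elim SA)) sm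
      into-S′ : ∀ u → (S u ∧ A u z) ∧ not (small u) ≡ true → S′ u ∧ A u z ≡ true
      into-S′ u e = let (SA , ¬sm) = ∧-elim {S u ∧ A u z} e in
        ∧-intro (∧-intro (proj₁ (∧-elim SA)) ¬sm) (proj₂ (∧-elim {S u} SA))

    τ≤d⁻-S′ : ∀ z → S′ z ≡ true → τ ≤ d⁻ T S′ z
    τ≤d⁻-S′ z S′z = <⇒≤ (+-cancelʳ-≤ (2 * τ) (suc τ) (d⁻ T S′ z) (begin
      suc (3 * τ)          ≤⟨ S′⇒3τ<d⁻ z S′z ⟩
      d⁻ T S z             ≤⟨ d⁻-S≤d⁻-S′+∣Lo∣ z ⟩
      d⁻ T S′ z + count Lo ≤⟨ +-monoʳ-≤ (d⁻ T S′ z) (≤-trans (m≤m+n (count Lo) 1) ∣Lo∣+1≤2τ) ⟩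
      d⁻ T S′ z + 2 * τ    ∎))
      where open ≤-Reasoning

    ∣S∣≡∣Lo∣+∣S′∣ : count S ≡ count Lo + count S′
    ∣S∣≡∣Lo∣+∣S′∣ = count-split S small

    1≤∣S′∣ : 1 ≤ count S′
    1≤∣S′∣ = +-cancelˡ-≤ (count Lo) 1 (count S′)
      (≤-trans ∣Lo∣+1≤2τ (≤-trans large (≤-reflexive ∣S∣≡∣Lo∣+∣S′∣)))

    w : Fin n
    w = proj₁ (∃-minimiser S′ (d⁻ T S′) (count-nonempty S′ 1≤∣S′∣))

    S′w : S′ w ≡ true
    S′w = proj₁ (proj₂ (∃-minimiser S′ (d⁻ T S′) (count-nonempty S′ 1≤∣S′∣)))

    w-minimal : ∀ u → S′ u ≡ true → d⁻ T S′ w ≤ d⁻ T S′ u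
    w-minimal = proj₂ (proj₂ (∃-minimiser S′ (d⁻ T S′) (count-nonempty S′ 1≤∣S′∣)))

    S″ : Fin n → Bool
    S″ = in-neighbours T S′ w

    S″⇒S′ : ∀ z → S″ z ≡ true → S′ z ≡ true
    S″⇒S′ z S″z = proj₁ (∧-elim {S′ z} S″z)

    2∣S″∣+1≤∣S′∣ : 2 * count S″ + 1 ≤ count S′
    2∣S″∣+1≤∣S′∣ with ∃-d⁻-≤-half T S′ 1≤∣S′∣
    ... | v₀ , S′v₀ , 2d+1≤∣S′∣ = ≤-trans (+-monoˡ-≤ 1 (*-monoʳ-≤ 2 (w-minimal v₀ S′v₀))) 2d+1≤∣S′∣

    τ≤∣S″∣ : τ ≤ count S″
    τ≤∣S″∣ = τ≤d⁻-S′ w S′w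

    module Extend (rest : LowerPart M′ r S″) where

      private
        module R = LowerPart rest

      X′ : Fin n → Bool
      X′ z = Lo z ∨ R.X z

      S″⇒S : ∀ z → S″ z ≡ true → S z ≡ true
      S″⇒S z S″z = S′⇒S z (S″⇒S′ z S″z)

      w∷b3b4⊆S : ∀ x → x ∈ᵇ (w ∷ R.b3 ++ R.b4) ≡ true → S x ≡ true
      w∷b3b4⊆S x x∈ with ∈ᵇ-∷⁻ {x = x} w (R.b3 ++ R.b4) x∈
      ... | inj₁ refl = S′⇒S w S′w
      ... | inj₂ x∈l  = S″⇒S x (R.b3b4⊆S x x∈l)

      X′⊆S : ∀ x → X′ x ≡ true → S x ≡ true
      X′⊆S x X′x with ∨-elim {Lo x} X′x
      ... | inj₁ Lo-x = proj₁ (∧-elim Lo-x)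
      ... | inj₂ Xx   = S″⇒S x (R.X⊆S x Xx)

      E∩X′≡∅ : ∀ x → R.E x ≡ true → X′ x ≡ false
      E∩X′≡∅ x Ex rewrite S′⇒¬Lo x (S″⇒S′ x (R.E⊆S x Ex)) = R.E∩X≡∅ x Ex

      ∣X′∣≤ : count X′ ≤ 2 * 2 ^ (suc r + M′)
      ∣X′∣≤ = begin
        count X′              ≤⟨ count-∨ Lo R.X ⟩
        count Lo + count R.X  ≤⟨ +-mono-≤ (≤-trans (m≤m+n (count Lo) 1) ∣Lo∣+1≤2τ) R.∣X∣≤ ⟩
        2 * τ + 2 * τ         ≡⟨ trans (sym (*-assoc 2 2 τ)) (*-distribʳ-+ τ 2 2) ⟨
        2 * (2 * τ)           ∎
        where open ≤-Reasoning

      ∣E∣+∣X′∣≤∣S∣ : 2 ^ suc r * count R.E + count X′ ≤ count S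
      ∣E∣+∣X′∣≤∣S∣ = begin
        2 ^ suc r * count R.E + count X′
          ≤⟨ +-monoʳ-≤ (2 ^ suc r * count R.E) (count-∨ Lo R.X) ⟩
        2 ^ suc r * count R.E + (count Lo + count R.X)
          ≡⟨ cong (_+ (count Lo + count R.X)) (*-assoc 2 (2 ^ r) (count R.E)) ⟩
        2 * e + (count Lo + count R.X)
          ≡⟨ x+[y+z]≡y+[x+z] (2 * e) (count Lo) (count R.X) ⟩
        count Lo + (2 * e + count R.X)
          ≤⟨ +-monoʳ-≤ (count Lo) (+-monoʳ-≤ (2 * e) (m≤m+n (count R.X) (count R.X + 0))) ⟩
        count Lo + (2 * e + 2 * count R.X)
          ≡⟨ cong (count Lo +_) (*-distribˡ-+ 2 e (count R.X)) ⟨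
        count Lo + 2 * (e + count R.X)
          ≤⟨ +-monoʳ-≤ (count Lo) (*-monoʳ-≤ 2 R.∣E∣+∣X∣≤∣S∣) ⟩
        count Lo + 2 * count S″
          ≤⟨ +-monoʳ-≤ (count Lo) (≤-trans (m≤m+n (2 * count S″) 1) 2∣S″∣+1≤∣S′∣) ⟩
        count Lo + count S′
          ≡⟨ ∣S∣≡∣Lo∣+∣S′∣ ⟨
        count S ∎
        where
        open ≤-Reasoning
        e = 2 ^ r * count R.E
        x+[y+z]≡y+[x+z] : ∀ x y z → x + (y + z) ≡ y + (x + z)
        x+[y+z]≡y+[x+z] x y z =
          trans (sym (+-assoc x y z)) (trans (cong (_+ z) (+-comm x y)) (+-assoc y x z))

      w∷b3-dominates : ∀ v → S v ≡ true → X′ v ≡ false → v ∈ᵇ (w ∷ R.b3 ++ R.b4) ≡ false →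
        R.E v ≡ false → ∃ λ w′ → w′ ∈ᵇ (w ∷ R.b3) ≡ true × A w′ v ≡ true
      w∷b3-dominates v Sv ¬X′v v∉ ¬Ev with A w v in Awv
      ... | true  = w , ∈ᵇ-here w R.b3 , Awv
      ... | false with R.b3-dominates v S″v (∨-falseʳ (Lo v) ¬X′v) (∨-falseʳ (v == w) v∉) ¬Ev
        where
        v≢w : v ≢ w
        v≢w refl = true≢false (∈ᵇ-here v (R.b3 ++ R.b4)) v∉
        S″v : S″ v ≡ true
        S″v = ∧-intro (∧-intro Sv (not-true (∧-falseʳ Sv (∨-falseˡ (Lo v) ¬X′v))))
                      (adj-flip T w v (λ w≡v → v≢w (sym w≡v)) Awv)
      ...   | w′ , w′∈ , Aw′v = w′ , ∈ᵇ-there w R.b3 w′∈ , Aw′v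

      -- Every u ∈ E lies in S′, where w has least in-degree, and |S″| = d⁻_{S′}(w).
      indegree-bound : InDegreeBound (suc r) S X′ R.E
      indegree-bound u Eu = +-cancelʳ-≤ (count R.X) (2 ^ r * count R.E) _ (begin
        2 ^ r * count R.E + count R.X
          ≤⟨ R.∣E∣+∣X∣≤∣S∣ ⟩
        count S″
          ≤⟨ w-minimal u S′u ⟩
        d⁻ T S′ u
          ≡⟨ count-split (λ z → S′ z ∧ A z u) (λ z → not (R.X z)) ⟩
        count (λ z → (S′ z ∧ A z u) ∧ not (R.X z)) + count (λ z → (S′ z ∧ A z u) ∧ not (not (R.X z)))
          ≤⟨ +-mono-≤ (count-mono outside-X′) (count-mono inside-X) ⟩
        count (λ z → (S z ∧ not (X′ z)) ∧ A z u) + count R.X ∎)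
        where
        open ≤-Reasoning
        S′u : S′ u ≡ true
        S′u = S″⇒S′ u (R.E⊆S u Eu)
        outside-X′ : ∀ z → (S′ z ∧ A z u) ∧ not (R.X z) ≡ true → (S z ∧ not (X′ z)) ∧ A z u ≡ true
        outside-X′ z e with ∧-elim {S′ z ∧ A z u} e
        ... | S′A , ¬X with ∧-elim {S′ z} S′A
        ...   | S′z , Azu rewrite S′⇒¬Lo z S′z | not-false ¬X =
          ∧-intro (∧-intro (S′⇒S z S′z) refl) Azu
        inside-X : ∀ z → (S′ z ∧ A z u) ∧ not (not (R.X z)) ≡ true → R.X z ≡ true
        inside-X z e with R.X z | proj₂ (∧-elim {S′ z ∧ A z u} e)
        ... | true | _ = refl

      extend : LowerPart M′ (suc r) S
      extend = record
        { b3 = w ∷ R.b3 ; b4 = R.b4 ; length-b3 = cong suc R.length-b3 ; length-b4 = R.length-b4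
        ; chain = (λ y y∈ → proj₂ (∧-elim {S′ y} (R.b3b4⊆S y y∈))) , R.chain
        ; b3b4⊆S = w∷b3b4⊆S
        ; X = X′ ; E = R.E
        ; X⊆S = X′⊆S ; E⊆S = λ x Ex → S″⇒S x (R.E⊆S x Ex) ; E∩X≡∅ = E∩X′≡∅
        ; ∣X∣≤ = ∣X′∣≤ ; ∣E∣+∣X∣≤∣S∣ = ∣E∣+∣X′∣≤∣S∣
        ; b3-dominates = w∷b3-dominates
        ; indegree-bound = indegree-bound
        }

  lowerPart : ∀ M′ r S → 2 ^ (r + M′) ≤ count S → LowerPart M′ r S
  lowerPart M′ zero    S large = lowerPart-zero M′ S large
  lowerPart M′ (suc r) S large
    with Fin.any? (λ v → (S v Bool.≟ true) ×-dec (2 ^ (r + M′) ≤? d⁻ T S v)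
                                           ×-dec (d⁻ T S v ≤? 3 * 2 ^ (r + M′)))
  ... | yes (v , Sv , τ≤d , d≤3τ) = lowerPart-middle M′ r S v Sv τ≤d d≤3τ
  ... | no no-middle = Step.Extend.extend M′ r S no-middle large
    (lowerPart M′ r (Step.S″ M′ r S no-middle large) (Step.τ≤∣S″∣ M′ r S no-middle large))

-- Assembling the outdominator

coprime-1 : ∀ a → Coprime a 1
coprime-1 a = Coprimality.sym (1-coprimeTo a)

⟦⟧≡mkℚ : ∀ a → ⟦ a ⟧ ≡ mkℚ (ℤ.+ a) 0 (coprime-1 a)
⟦⟧≡mkℚ a = ℚ.normalize-coprime (coprime-1 a)

⟦⟧-mono-≤ : ∀ {a b} → a ≤ b → ⟦ a ⟧ ℚ.≤ ⟦ b ⟧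
⟦⟧-mono-≤ {a} {b} a≤b rewrite ⟦⟧≡mkℚ a | ⟦⟧≡mkℚ b =
  ℚ.*≤* (subst₂ ℤ._≤_ (sym (ℤ.*-identityʳ (ℤ.+ a))) (sym (ℤ.*-identityʳ (ℤ.+ b))) (ℤ.+≤+ a≤b))

⟦⟧-+ : ∀ a b → ⟦ a + b ⟧ ≡ ⟦ a ⟧ ℚ.+ ⟦ b ⟧
⟦⟧-+ a b rewrite ⟦⟧≡mkℚ a | ⟦⟧≡mkℚ b =
  cong (ℚ._/ 1) (sym (cong₂ ℤ._+_ (ℤ.*-identityʳ (ℤ.+ a)) (ℤ.*-identityʳ (ℤ.+ b))))

⟦⟧-* : ∀ a b → ⟦ a * b ⟧ ≡ ⟦ a ⟧ ℚ.* ⟦ b ⟧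
⟦⟧-* a b rewrite ⟦⟧≡mkℚ a | ⟦⟧≡mkℚ b = cong (ℚ._/ 1) (ℤ.pos-* a b)

⟦⟧-nonNeg : ∀ a → ℚ.NonNegative ⟦ a ⟧
⟦⟧-nonNeg a = ℚ.normalize-nonNeg a 1

module _ {n : ℕ} (T : Tournament n) (Y : Subset n) where

  good : Fin n → Bool
  good x = isLarge T x ∧ not (Vec.lookup Y x)

  many-good : ∀ k → 1 ≤ n → 25 * (∣ Y ∣ + 2 ^ k * 2 ^ k) ≤ n → 2 ^ k * 2 ^ k ≤ count good
  many-good k 1≤n bound = +-cancelˡ-≤ (count y) (2 ^ k * 2 ^ k) (count good) (*-cancelˡ-≤ 25 (begin
    25 * (count y + 2 ^ k * 2 ^ k)  ≡⟨ cong (λ c → 25 * (c + 2 ^ k * 2 ^ k)) (∣p∣≡count Y) ⟨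
    25 * (∣ Y ∣ + 2 ^ k * 2 ^ k)    ≤⟨ bound ⟩
    n                               ≤⟨ many-large-outdegree T 1≤n ⟩
    25 * count (isLarge T)          ≤⟨ *-monoʳ-≤ 25 large≤y+good ⟩
    25 * (count y + count good)     ∎))
    where
    open ≤-Reasoning
    y = Vec.lookup Y
    large≤y+good : count (isLarge T) ≤ count y + count good
    large≤y+good = ≤-trans (≤-reflexive (count-split (isLarge T) y))
      (+-monoˡ-≤ (count good) (count-mono (λ x e → proj₂ (∧-elim {isLarge T x} e))))

  upperPart : ∀ a b → 1 ≤ n → 25 * (∣ Y ∣ + 2 ^ (a + b) * 2 ^ (a + b)) ≤ n →
    Σ (List (Fin n)) λ b1 → Σ (List (Fin n)) λ b2 →
      length b1 ≡ a × length b2 ≡ b × Chain T (b1 ++ b2)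
      × (∀ x → x ∈ᵇ (b1 ++ b2) ≡ true → good x ≡ true)
      × 2 ^ (a + b) ≤ count (λ z → not (Vec.lookup Y z) ∧ beatsAll T b2 z)
  upperPart a b 1≤n bound =
    let (l , ∣l∣ , chain , l⊆good , 2ᵏ≤∣dominators∣) =
          chain-with-common-dominators T (a + b) (2 ^ (a + b)) good (m^n>0 2 (a + b))
                                       (many-good (a + b) 1≤n bound)
        (b1 , b2 , l≡b1++b2 , ∣b1∣ , ∣b2∣) = splitAt-length a b l ∣l∣
        dominator⇒Q : ∀ z → good z ∧ beatsAll T l z ≡ true →
                      not (Vec.lookup Y z) ∧ beatsAll T b2 z ≡ true
        dominator⇒Q z e = let (good-z , beats) = ∧-elim {good z} e in
          ∧-intro (proj₂ (∧-elim {isLarge T z} good-z))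
                  (beatsAll-++⁻ʳ T b1 b2 z (subst (λ l′ → beatsAll T l′ z ≡ true) l≡b1++b2 beats))
    in b1 , b2 , ∣b1∣ , ∣b2∣ , subst (Chain T) l≡b1++b2 chain ,
       (λ x x∈ → l⊆good x (subst (λ l′ → x ∈ᵇ l′ ≡ true) (sym l≡b1++b2) x∈)) ,
       ≤-trans 2ᵏ≤∣dominators∣ (count-mono dominator⇒Q)

module Assembly {n : ℕ} (T : Tournament n) (Y : Subset n) (M′ m′ : ℕ)
  (b1 b2 : List (Fin n)) (length-b1 : length b1 ≡ suc M′) (length-b2 : length b2 ≡ suc m′)
  (chain12 : Chain T (b1 ++ b2)) (b12-good : ∀ x → x ∈ᵇ (b1 ++ b2) ≡ true → good T Y x ≡ true)
  (lower : LowerPart T M′ (suc m′) (λ z → not (Vec.lookup Y z) ∧ beatsAll T b2 z)) where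

  private
    module R = LowerPart lower
    A = adj T
    y = Vec.lookup Y

  -- inV, exc and inW are membership in V(D⁺), in the exceptional set X, and in
  -- W = (V(T) ∖ X) ∪ V(D⁺), the vertex set of the subtournament D⁺ lives in.
  Q inV exc inW : Fin n → Bool
  Q z = not (y z) ∧ beatsAll T b2 z
  inV x = x ∈ᵇ b1 ∨ (x ∈ᵇ b2 ∨ (x ∈ᵇ R.b3 ∨ x ∈ᵇ R.b4))
  exc x = y x ∨ R.X x
  inW x = not (exc x) ∨ inV x

  D : Outdom T
  D = mkOutdom (tabulate (_∈ᵇ b1)) (tabulate (_∈ᵇ b2)) (tabulate (_∈ᵇ R.b3)) (tabulate (_∈ᵇ R.b4))
               (tabulate R.E)

  X : Subset n
  X = tabulate exc

  VD≡ : VD T D ≡ tabulate inV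
  VD≡ = trans (cong (tabulate (_∈ᵇ b1) ∪_) (trans (cong (tabulate (_∈ᵇ b2) ∪_)
          (tabulate-∪ (_∈ᵇ R.b3) (_∈ᵇ R.b4))) (tabulate-∪ (_∈ᵇ b2) _))) (tabulate-∪ (_∈ᵇ b1) _)

  W≡ : ∁ X ∪ VD T D ≡ tabulate inW
  W≡ = trans (cong₂ _∪_ (∁-tabulate exc) VD≡) (tabulate-∪ (λ x → not (exc x)) inV)

  Q⇒¬Y : ∀ x → Q x ≡ true → y x ≡ false
  Q⇒¬Y x Qx = not-false (proj₁ (∧-elim {not (y x)} Qx))

  b3⊆Q : ∀ x → x ∈ᵇ R.b3 ≡ true → Q x ≡ true
  b3⊆Q x x∈ = R.b3b4⊆S x (∈ᵇ-++⁺ˡ R.b3 R.b4 x∈)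

  b4⊆Q : ∀ x → x ∈ᵇ R.b4 ≡ true → Q x ≡ true
  b4⊆Q x x∈ = R.b3b4⊆S x (∈ᵇ-++⁺ʳ R.b3 R.b4 x∈)

  inV⇒¬Y : ∀ x → inV x ≡ true → y x ≡ false
  inV⇒¬Y x x∈V with ∨-elim {x ∈ᵇ b1} x∈V
  ... | inj₁ x∈b1 = not-false (proj₂ (∧-elim {isLarge T x} (b12-good x (∈ᵇ-++⁺ˡ b1 b2 x∈b1))))
  ... | inj₂ x∈V′ with ∨-elim {x ∈ᵇ b2} x∈V′
  ...   | inj₁ x∈b2 = not-false (proj₂ (∧-elim {isLarge T x} (b12-good x (∈ᵇ-++⁺ʳ b1 b2 x∈b2))))
  ...   | inj₂ x∈V″ with ∨-elim {x ∈ᵇ R.b3} x∈V″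
  ...     | inj₁ x∈b3 = Q⇒¬Y x (b3⊆Q x x∈b3)
  ...     | inj₂ x∈b4 = Q⇒¬Y x (b4⊆Q x x∈b4)

  b1∩Q≡∅ : ∀ x → x ∈ᵇ b1 ≡ true → Q x ≡ true → ⊥
  b1∩Q≡∅ x x∈b1 Qx = adj-asym T x c
    (beatsAll-∈ᵇ T b2 x c (proj₂ (∧-elim {not (y x)} Qx)) c∈b2)
    (Chain-++⇒beats T b1 b2 chain12 x c x∈b1 c∈b2)
    where
    c = proj₁ (∃-∈ᵇ b2 length-b2)
    c∈b2 = proj₂ (∃-∈ᵇ b2 length-b2)

  b2∩Q≡∅ : ∀ x → x ∈ᵇ b2 ≡ true → Q x ≡ true → ⊥
  b2∩Q≡∅ x x∈b2 Qx = true≢false x∈b2 (beatsAll⇒∉ T b2 x (proj₂ (∧-elim {not (y x)} Qx)))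

  chain23 : Chain T (b2 ++ R.b3)
  chain23 = Chain-++⁺ T b2 R.b3 (Chain-++⁻ʳ T b1 b2 chain12) (Chain-++⁻ˡ T R.b3 R.b4 R.chain)
    (λ x z x∈b2 z∈b3 → beatsAll-∈ᵇ T b2 z x (proj₂ (∧-elim {not (y z)} (b3⊆Q z z∈b3))) x∈b2)

  ∣tabulate-∈ᵇ∣ : ∀ l → Chain T l → ∣ tabulate (_∈ᵇ l) ∣ ≡ length l
  ∣tabulate-∈ᵇ∣ l chain = trans (∣tabulate∣≡count (_∈ᵇ l)) (count-∈ᵇ T l chain)

  unexceptional⇒W : ∀ x → y x ≡ false → R.X x ≡ false → inW x ≡ true
  unexceptional⇒W x ¬Yx ¬Xx rewrite ¬Yx | ¬Xx = refl

  parts⊆W : (B1 D ∪ B2 D ∪ B3 D ∪ B4 D ∪ E⁺ D) ⊆ tabulate inW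
  parts⊆W x∈ with Subset.x∈p∪q⁻ (B1 D) _ x∈
  ... | inj₁ x∈b1 = ⊆-tabulate (λ x e → ∨-introʳ (not (exc x)) (∨-introˡ _ e)) x∈b1
  ... | inj₂ x∈′ with Subset.x∈p∪q⁻ (B2 D) _ x∈′
  ...   | inj₁ x∈b2 = ⊆-tabulate (λ x e → ∨-introʳ (not (exc x))
                         (∨-introʳ (x ∈ᵇ b1) (∨-introˡ _ e))) x∈b2
  ...   | inj₂ x∈″ with Subset.x∈p∪q⁻ (B3 D) _ x∈″
  ...     | inj₁ x∈b3 = ⊆-tabulate (λ x e → ∨-introʳ (not (exc x))
                           (∨-introʳ (x ∈ᵇ b1) (∨-introʳ (x ∈ᵇ b2) (∨-introˡ _ e)))) x∈b3
  ...     | inj₂ x∈‴ with Subset.x∈p∪q⁻ (B4 D) _ x∈‴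
  ...       | inj₁ x∈b4 = ⊆-tabulate (λ x e → ∨-introʳ (not (exc x))
                             (∨-introʳ (x ∈ᵇ b1) (∨-introʳ (x ∈ᵇ b2) (∨-introʳ (x ∈ᵇ R.b3) e)))) x∈b4
  ...       | inj₂ x∈E  = ⊆-tabulate E⇒W x∈E
    where
    E⇒W : ∀ x → R.E x ≡ true → inW x ≡ true
    E⇒W x Ex = unexceptional⇒W x (Q⇒¬Y x (R.E⊆S x Ex)) (R.E∩X≡∅ x Ex)

  -- A remaining vertex beating all of B² lies in Q, where B³ dominates it; any other is beaten
  -- by a vertex of B².
  dominates : OutDominates T (B2 D ∪ B3 D) (tabulate inW ∩ ∁ (tabulate inV ∪ E⁺ D))
  dominates b b∈ _ with Subset.x∈p∩q⁻ (tabulate inW) _ b∈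
  ... | b∈W , b∉V∪E
    with ∈-tabulate⁻ b∈W
       | not-false (∈-tabulate⁻ (subst (b ∈_) (trans (cong ∁ (tabulate-∪ inV R.E)) (∁-tabulate _)) b∉V∪E))
  ... | Wb | ¬[Vb∨Eb] with beatsAll T b2 b in beats
  ...   | true  = let (w , w∈b3 , Awb) = R.b3-dominates b Qb ¬Xb b∉b3b4 ¬Eb in
                  w , Subset.x∈p∪q⁺ (inj₂ (∈-tabulate⁺ w∈b3)) , Awb
    where
    ¬Vb = ∨-falseˡ (inV b) ¬[Vb∨Eb]
    ¬Eb = ∨-falseʳ (inV b) ¬[Vb∨Eb]
    ¬exc = not-false (∨-trueˡ Wb ¬Vb)
    ¬Xb = ∨-falseʳ (y b) ¬exc
    Qb : Q b ≡ true
    Qb = ∧-intro (not-true (∨-falseˡ (y b) ¬exc)) beats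
    b∉b3b4 : b ∈ᵇ (R.b3 ++ R.b4) ≡ false
    b∉b3b4 = trans (∈ᵇ-++ b R.b3 R.b4) (∨-falseʳ (b ∈ᵇ b2) (∨-falseʳ (b ∈ᵇ b1) ¬Vb))
  ...   | false = let (c , c∈b2 , Abc) = beatsAll-false T b2 b beats in
                  c , Subset.x∈p∪q⁺ (inj₁ (∈-tabulate⁺ c∈b2)) , adj-flip T b c (b≢c c c∈b2) Abc
    where
    ¬Vb = ∨-falseˡ (inV b) ¬[Vb∨Eb]
    b≢c : ∀ c → c ∈ᵇ b2 ≡ true → b ≢ c
    b≢c c c∈b2 refl = true≢false c∈b2 (∨-falseˡ (b ∈ᵇ b2) (∨-falseʳ (b ∈ᵇ b1) ¬Vb))

  d⁻-W-bound : ∀ v → R.E v ≡ true → 2 ^ m′ * count R.E ≤ d⁻ T inW v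
  d⁻-W-bound v Ev = ≤-trans (R.indegree-bound v Ev) (count-mono Q∖X⇒W)
    where
    Q∖X⇒W : ∀ z → (Q z ∧ not (R.X z)) ∧ A z v ≡ true → inW z ∧ A z v ≡ true
    Q∖X⇒W z e with ∧-elim {Q z ∧ not (R.X z)} e
    ... | Q∖X , Azv with ∧-elim {Q z} Q∖X
    ...   | Qz , ¬Xz = ∧-intro (unexceptional⇒W z (Q⇒¬Y z Qz) (not-false ¬Xz)) Azv

  indegree-condition : ∀ p → p ℚ.≤ ⟦ 2 ^ m′ ⟧ →
    ∀ v → v ∈ E⁺ D → p ℚ.* ⟦ ∣ E⁺ D ∣ ⟧ ℚ.≤ ⟦ indegIn T (tabulate inW) v ⟧
  indegree-condition p p≤2^m′ v v∈E = begin
    p ℚ.* ⟦ e ⟧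
      ≤⟨ ℚ.*-monoʳ-≤-nonNeg ⟦ e ⟧ {{⟦⟧-nonNeg e}} p≤2^m′ ⟩
    ⟦ 2 ^ m′ ⟧ ℚ.* ⟦ e ⟧
      ≡⟨ ⟦⟧-* (2 ^ m′) e ⟨
    ⟦ 2 ^ m′ * e ⟧
      ≤⟨ ⟦⟧-mono-≤ (≤-trans (≤-reflexive (cong (2 ^ m′ *_) (∣tabulate∣≡count R.E)))
                           (d⁻-W-bound v (∈-tabulate⁻ v∈E))) ⟩
    ⟦ d⁻ T inW v ⟧
      ≡⟨ cong ⟦_⟧ (trans (cong ∣_∣ (tabulate-∩ inW (λ u → A u v)))
                         (∣tabulate∣≡count (λ u → inW u ∧ A u v))) ⟨
    ⟦ indegIn T (tabulate inW) v ⟧ ∎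
    where
    open ℚ.≤-Reasoning
    e = ∣ E⁺ D ∣

  isOutdominator : ∀ p → p ℚ.≤ ⟦ 2 ^ m′ ⟧ → IsOutdominatorExc T (suc m′) (suc M′) p X D
  isOutdominator p p≤2^m′ = subst (λ W → IsOutdominatorIn T (suc m′) (suc M′) p W D) (sym W≡)
    ( parts⊆W
    , Disjoint-tabulate T (λ x x∈b1 x∈b2 → true≢false x∈b2 (Chain-++-disjoint T b1 b2 chain12 x x∈b1))
    , Disjoint-tabulate T (λ x x∈b1 x∈b3 → b1∩Q≡∅ x x∈b1 (b3⊆Q x x∈b3))
    , Disjoint-tabulate T (λ x x∈b1 x∈b4 → b1∩Q≡∅ x x∈b1 (b4⊆Q x x∈b4))
    , Disjoint-tabulate T (λ x x∈b2 x∈b3 → b2∩Q≡∅ x x∈b2 (b3⊆Q x x∈b3))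
    , Disjoint-tabulate T (λ x x∈b2 x∈b4 → b2∩Q≡∅ x x∈b2 (b4⊆Q x x∈b4))
    , Disjoint-tabulate T (λ x x∈b3 x∈b4 → true≢false x∈b4 (Chain-++-disjoint T R.b3 R.b4 R.chain x x∈b3))
    , Chain⇒TransitiveHeadTail T b1 b2 (nonempty b1 length-b1) (nonempty b2 length-b2) chain12
    , Chain⇒TransitiveHeadTail T b2 R.b3 (nonempty b2 length-b2) (nonempty R.b3 R.length-b3) chain23
    , Chain⇒TransitiveHeadTail T R.b3 R.b4 (nonempty R.b3 R.length-b3) (nonempty R.b4 R.length-b4) R.chain
    , trans (∣tabulate-∈ᵇ∣ b2 (Chain-++⁻ʳ T b1 b2 chain12)) length-b2
    , trans (∣tabulate-∈ᵇ∣ R.b3 (Chain-++⁻ˡ T R.b3 R.b4 R.chain)) R.length-b3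
    , trans (∣tabulate-∈ᵇ∣ b1 (Chain-++⁻ˡ T b1 b2 chain12)) length-b1
    , trans (∣tabulate-∈ᵇ∣ R.b4 (Chain-++⁻ʳ T R.b3 R.b4 R.chain)) R.length-b4
    , subst (λ V → OutDominates T (B2 D ∪ B3 D) (tabulate inW ∩ ∁ (V ∪ E⁺ D))) (sym VD≡) dominates
    , indegree-condition p p≤2^m′ )
    where
    nonempty : ∀ (l : List (Fin n)) {k} → length l ≡ suc k → 1 ≤ length l
    nonempty _ ∣l∣≡k+1 = subst (1 ≤_) (sym ∣l∣≡k+1) (s≤s z≤n)

  Y∩VD≡∅ : Empty (Y ∩ VD T D)
  Y∩VD≡∅ (x , x∈) with Subset.x∈p∩q⁻ Y (VD T D) x∈
  ... | x∈Y , x∈VD =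
    true≢false (Vec.[]=⇒lookup x∈Y) (inV⇒¬Y x (∈-tabulate⁻ (subst (x ∈_) VD≡ x∈VD)))

  Y⊆X : Y ⊆ X
  Y⊆X {x} x∈Y = ∈-tabulate⁺ (∨-introˡ (R.X x) (Vec.[]=⇒lookup x∈Y))

  ∣X∣≤ : ∣ X ∣ ≤ 2 ^ (suc m′ + suc M′) + ∣ Y ∣
  ∣X∣≤ = begin
    ∣ X ∣                              ≡⟨ ∣tabulate∣≡count exc ⟩
    count exc                          ≤⟨ count-∨ y R.X ⟩
    count y + count R.X                ≤⟨ +-monoʳ-≤ (count y) R.∣X∣≤ ⟩
    count y + 2 * 2 ^ (suc m′ + M′)    ≡⟨ cong₂ _+_ (∣p∣≡count Y) (cong (2 ^_) (+-suc (suc m′) M′)) ⟨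
    ∣ Y ∣ + 2 ^ (suc m′ + suc M′)      ≡⟨ +-comm ∣ Y ∣ _ ⟩
    2 ^ (suc m′ + suc M′) + ∣ Y ∣      ∎
    where open ≤-Reasoning

  B1-large : ∀ v → v ∈ B1 D → LargeOutdeg T v
  B1-large v v∈ = isLarge⇒LargeOutdeg T v
    (proj₁ (∧-elim {isLarge T v} (b12-good v (∈ᵇ-++⁺ˡ b1 b2 (∈-tabulate⁻ v∈)))))

  ∣X∣≤L+∣Y∣ : ∀ L → ⟦ 2 ^ (suc m′ + suc M′) + suc m′ + suc M′ ⟧ ℚ.≤ L →
    ⟦ ∣ X ∣ ⟧ ℚ.≤ L ℚ.+ ⟦ ∣ Y ∣ ⟧
  ∣X∣≤L+∣Y∣ L hL = begin
    ⟦ ∣ X ∣ ⟧           ≤⟨ ⟦⟧-mono-≤ (≤-trans ∣X∣≤ (+-monoˡ-≤ ∣ Y ∣ 2ᵏ≤c)) ⟩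
    ⟦ c + ∣ Y ∣ ⟧       ≡⟨ ⟦⟧-+ c ∣ Y ∣ ⟩
    ⟦ c ⟧ ℚ.+ ⟦ ∣ Y ∣ ⟧ ≤⟨ ℚ.+-monoˡ-≤ ⟦ ∣ Y ∣ ⟧ hL ⟩
    L ℚ.+ ⟦ ∣ Y ∣ ⟧     ∎
    where
    open ℚ.≤-Reasoning
    c = 2 ^ (suc m′ + suc M′) + suc m′ + suc M′
    2ᵏ≤c : 2 ^ (suc m′ + suc M′) ≤ c
    2ᵏ≤c = ≤-trans (m≤m+n _ (suc m′)) (m≤m+n _ (suc M′))

2^[2m+2M]≡2^[M+m]*2^[M+m] : ∀ m M → 2 ^ (2 * m + 2 * M) ≡ 2 ^ (M + m) * 2 ^ (M + m)
2^[2m+2M]≡2^[M+m]*2^[M+m] m M = trans (cong (2 ^_) exponents) (^-distribˡ-+-* 2 (M + m) (M + m))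
  where
  exponents : 2 * m + 2 * M ≡ (M + m) + (M + m)
  exponents = trans (sym (*-distribˡ-+ 2 m M))
                    (trans (cong (2 *_) (+-comm m M)) (cong ((M + m) +_) (+-identityʳ (M + m))))

lemma3p10 : (m M : ℕ) (L p : ℚ) → 1 ≤ m → 1 ≤ M
    → ⟦ 2 ^ (m + M) + m + M ⟧ ℚ.≤ L
    → p ℚ.≤ ⟦ 2 ^ (m ∸ 1) ⟧
    → (n : ℕ) (T : Tournament n)
    → 25 * 2 ^ (2 * m + 2 * M) ≤ n
    → (Y : Subset n)
    → 25 * (∣ Y ∣ + 2 ^ (2 * m + 2 * M)) ≤ n
    → Σ (Outdom T) λ D → Σ (Subset n) λ X →
        IsOutdominatorExc T m M p X D
        × Empty (Y ∩ VD T D)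
        × Y ⊆ X
        × ⟦ ∣ X ∣ ⟧ ℚ.≤ L ℚ.+ ⟦ ∣ Y ∣ ⟧
        × (∀ v → v ∈ B1 D → LargeOutdeg T v)
lemma3p10 (suc m′) (suc M′) L p _ _ hL hp n T n-large Y Y-small =
  let 1≤n = ≤-trans (≤-trans (m^n>0 2 (2 * suc m′ + 2 * suc M′)) (m≤n*m _ 25)) n-large
      bound = subst (λ k → 25 * (∣ Y ∣ + k) ≤ n) (2^[2m+2M]≡2^[M+m]*2^[M+m] (suc m′) (suc M′)) Y-small
      (b1 , b2 , ∣b1∣ , ∣b2∣ , chain , b12-good , 2ᵏ≤∣Q∣) = upperPart T Y (suc M′) (suc m′) 1≤n bound
      exponent≤ = ≤-trans (≤-reflexive (+-comm (suc m′) M′)) (n≤1+n (M′ + suc m′))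
      open Assembly T Y M′ m′ b1 b2 ∣b1∣ ∣b2∣ chain b12-good
             (lowerPart T M′ (suc m′) _ (≤-trans (^-monoʳ-≤ 2 exponent≤) 2ᵏ≤∣Q∣))
  in D , X , isOutdominator p hp , Y∩VD≡∅ , Y⊆X , ∣X∣≤L+∣Y∣ L hL , B1-large
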